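{- The Shortest-Paths-and-Greedy-Delays algorithm described in the context has approximation ratio \(\Theta(k)\) for min-sum Time Disjoint Walks on bounded-degree digraphs: there is a constant \(C\) such that on every instance with \(k\) demands (on any digraph) and for every way of breaking ties, the output's cost is at most \(C\cdot k\) times the optimal min-sum cost; and there are a fixed integer \(D\), a constant \(c>0\), and, for infinitely many values of \(k\), an instance with \(k\) demands whose digraph has maximum total degree at most \(D\), together with a valid way of breaking ties, on which the output's cost is at least \(c\cdot k\) times the optimal min-sum cost.
   Context: Notation: for integers \(a,b\), \([a,b]=\{x\in\mathbb{Z}: a\le x\le b\}\) and \([b]=[1,b]\). Digraphs are finite and have no parallel arcs in the same direction; the total degree of a vertex is its indegree plus outdegree. Let \(G=(V,E)\) be a digraph with arc lengths \(\lambda:E\to\mathbb{Z}_{\ge1}\). A walk from \(u\) to \(v\) is a tuple \(W=(w_1,\dots,w_l)\) of vertices with \(w_1=u\), \(w_l=v\), \((w_i,w_{i+1})\in E\) for all \(i\in[l-1]\) (vertices may repeat). For \(j\in[l]\) let \(\lambda(W,j)=\sum_{i\in[j-1]}\lambda(w_i,w_{i+1})\) and \(\lambda(W)=\lambda(W,l)\); for a path (no repeated vertices) and a vertex \(v=w_j\) on it write \(\lambda(W,v)=\lambda(W,j)\). Given delays \(d_1,d_2\in\mathbb{Z}_{\ge0}\) and walks \(W_1,W_2\), the pairs \((d_1,W_1)\) and \((d_2,W_2)\) are time disjoint if for every \(j_1\in[|W_1|]\), \(j_2\in[|W_2|]\) such that the \(j_1\)-th vertex of \(W_1\) equals the \(j_2\)-th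 vertex of \(W_2\), we have \(d_1+\lambda(W_1,j_1)\ne d_2+\lambda(W_2,j_2)\). Time Disjoint Walks (TDW): an instance is \((G,\lambda,\mathcal{T})\) with \(\mathcal{T}=\{(s_1,t_1),\dots,(s_k,t_k)\}\subseteq V^2\) a set of \(k\) demands across unique vertices, such that for each \(i\) there is a walk from \(s_i\) to \(t_i\). A feasible solution is a choice, for each \(i\in[k]\), of a delay \(d_i\in\mathbb{Z}_{\ge0}\) and a walk \(W_i\) from \(s_i\) to \(t_i\), such that the pairs \((d_i,W_i)\) are pairwise time disjoint. Min-sum TDW minimizes \(\sum_{i\in[k]}(d_i+\lambda(W_i))\). Shortest-Paths-and-Greedy-Delays algorithm: for each \(i\in[k]\), compute a shortest (minimum \(\lambda\)-length) path \(W_i\) from \(s_i\) to \(t_i\) (e.g. by Dijkstra; ties broken arbitrarily). Relabel the demands so that \(\lambda(W_1)\le\lambda(W_2)\le\dots\le\lambda(W_k)\) (ties broken arbitrarily). Then for \(i=1,\dots,k\) in order, let \(B_i=\{d_h+\lambda(W_h,v)-\lambda(W_i,v): h\in[i-1],\ v \text{ a vertex lying on both } W_h \text{ and } W_i\}\) and set \(d_i=\min(\mathbb{Z}_{\ge0}\setminus B_i)\). Output \(\{(d_i,W_i): i\in[k]\}\). -}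

module Defs where

open import Data.Nat using (ℕ; zero; suc; _+_; _*_; _≤_; _<_)
open import Data.Bool using (Bool; true; false; T; if_then_else_)
open import Data.Fin using (Fin; toℕ) renaming (_<_ to _<ᶠ_)
open import Data.List using (List; []; _∷_; length; lookup; take; map; allFin)
open import Data.Nat.ListAction using (sum)
open import Data.List.Relation.Unary.Unique.Propositional using (Unique)
open import Data.Product using (Σ; ∃; ∃-syntax; _×_; _,_)
open import Data.Empty using (⊥)
open import Function.Definitions using (Injective)
open import Relation.Binary.PropositionalEquality using (_≡_; _≢_)
open import Relation.Nullary using (¬_)

-- Vertices are Fin n; arcs are given by a Boolean adjacency relation
-- (so no parallel arcs in the same direction); arc lengths are ≥ 1 on arcs.

module _ {n : ℕ} (arc : Fin n → Fin n → Bool) where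

  IsWalkFrom : Fin n → List (Fin n) → Fin n → Set
  IsWalkFrom u []       v = u ≡ v
  IsWalkFrom u (x ∷ xs) v = T (arc u x) × IsWalkFrom x xs v

  IsWalk : Fin n → Fin n → List (Fin n) → Set
  IsWalk u v []       = ⊥
  IsWalk u v (w ∷ ws) = (w ≡ u) × IsWalkFrom w ws v

module _ {n : ℕ} (len : Fin n → Fin n → ℕ) where

  walkLen : List (Fin n) → ℕ
  walkLen []           = 0
  walkLen (x ∷ [])     = 0
  walkLen (x ∷ y ∷ ws) = len x y + walkLen (y ∷ ws)

  -- λ(W, j) for the vertex at (0-based) position j, i.e. length of the
  -- prefix w₁ … w_{j+1}
  prefLen : (W : List (Fin n)) → Fin (length W) → ℕ
  prefLen W j = walkLen (take (suc (toℕ j)) W)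

record Instance : Set where
  field
    n       : ℕ
    arc     : Fin n → Fin n → Bool
    len     : Fin n → Fin n → ℕ
    len-pos : ∀ u v → T (arc u v) → 1 ≤ len u v
    k       : ℕ
    s t     : Fin k → Fin n
    s-inj   : ∀ i j → s i ≡ s j → i ≡ j
    t-inj   : ∀ i j → t i ≡ t j → i ≡ j
    s≢t     : ∀ i j → s i ≢ t j
    reach   : ∀ i → ∃[ W ] IsWalk arc (s i) (t i) W

module _ (I : Instance) where
  open Instance I

  outdeg indeg totalDeg : Fin n → ℕ
  outdeg v = sum (map (λ u → if arc v u then 1 else 0) (allFin n))
  indeg  v = sum (map (λ u → if arc u v then 1 else 0) (allFin n))
  totalDeg v = indeg v + outdeg v

  MaxDegreeAtMost : ℕ → Set
  MaxDegreeAtMost D = ∀ v → totalDeg v ≤ D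

  TimeDisjoint : ℕ → List (Fin n) → ℕ → List (Fin n) → Set
  TimeDisjoint d₁ W₁ d₂ W₂ =
    ∀ (j₁ : Fin (length W₁)) (j₂ : Fin (length W₂)) →
      lookup W₁ j₁ ≡ lookup W₂ j₂ →
      d₁ + prefLen len W₁ j₁ ≢ d₂ + prefLen len W₂ j₂

  Feasible : (Fin k → ℕ) → (Fin k → List (Fin n)) → Set
  Feasible d W =
    (∀ i → IsWalk arc (s i) (t i) (W i)) ×
    (∀ i j → i ≢ j → TimeDisjoint (d i) (W i) (d j) (W j))

  cost : (Fin k → ℕ) → (Fin k → List (Fin n)) → ℕ
  cost d W = sum (map (λ i → d i + walkLen len (W i)) (allFin k))

  Optimal : (Fin k → ℕ) → (Fin k → List (Fin n)) → Set
  Optimal d W = Feasible d W ×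
    (∀ d' W' → Feasible d' W' → cost d W ≤ cost d' W')

  IsShortestPath : Fin n → Fin n → List (Fin n) → Set
  IsShortestPath u v P = IsWalk arc u v P × Unique P ×
    (∀ P' → IsWalk arc u v P' → Unique P' → walkLen len P ≤ walkLen len P')

  -- (d, W) is a possible output of Shortest-Paths-and-Greedy-Delays, for
  -- some tie-breaking: W i are shortest paths, σ is the relabelling
  -- (σ i = original index of the i-th processed demand) sorting the path
  -- lengths nondecreasingly, and each d (σ i) = min (ℕ ∖ Bᵢ).
  module _ (d : Fin k → ℕ) (W : Fin k → List (Fin n)) (σ : Fin k → Fin k) where

    -- x ∈ Bᵢ  ⇔  x = d_h + λ(W_h, v) − λ(W_i, v) for some h < i, v on both
    InB : Fin k → ℕ → Set
    InB i x = ∃[ h ] (h <ᶠ i) ×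
      (∃[ j₁ ] ∃[ j₂ ] (lookup (W (σ h)) j₁ ≡ lookup (W (σ i)) j₂) ×
         (d (σ h) + prefLen len (W (σ h)) j₁ ≡ x + prefLen len (W (σ i)) j₂))

    GreedyDelay : Fin k → Set
    GreedyDelay i = ¬ InB i (d (σ i)) × (∀ x → x < d (σ i) → InB i x)

  AlgOutput : (Fin k → ℕ) → (Fin k → List (Fin n)) → Set
  AlgOutput d W = Σ (Fin k → Fin k) λ σ → Injective _≡_ _≡_ σ ×
    (∀ i → IsShortestPath (s i) (t i) (W i)) ×
    (∀ i j → i <ᶠ j → walkLen len (W (σ i)) ≤ walkLen len (W (σ j))) ×
    (∀ i → GreedyDelay d W σ i)

module Submission where

-- Upper bound (C = 3).  Loop erasure turns every walk into a path that is
-- no longer, so a shortest path W_i is no longer than any walk from s_i to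
-- t_i.  Every value x below the greedy delay d_i lies in B_i, witnessed by
-- an earlier demand h and a position on W_i; since W_h is a path, the
-- witness determines x, and pigeonhole gives d_i ≤ k·|W_i| ≤ 2k·λ(W_i).
-- Hence d_i + λ(W_i) ≤ 3k·λ(W_i) ≤ 3k·(d'_i + λ(W'_i)) for any feasible
-- (d', W'), and summing over the demands gives the bound.
--
-- Lower bound (D = 8, ratio k/12).  For k = k' + 1 demands we build a
-- graph of maximum degree 8 around a core path on k vertices.  Demand q
-- reaches the core through an entry lane, traverses it upwards or
-- downwards according to the parity of its pair index ⌊q/2⌋, and leaves
-- through an exit lane.  All these routes have length L = 3(k' + 2); a
-- direct arc s_q → t_q of length L makes them shortest paths (shown with a
-- sub-distance function) and makes the delay-free direct solution optimal,
-- with cost kL.  An explicit timetable shows that the greedy delays are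
-- ⌊q/2⌋·(k' + 2): at these delays no two routes collide, while every
-- smaller delay collides on the core with an earlier demand running in the
-- opposite direction, or with the other member of q's pair.  Summing,
-- the greedy cost is at least k · kL / 12.

open import Defs
open import Data.Nat using (ℕ; zero; suc; _+_; _*_; _∸_; _≤_; _<_; z≤n; s≤s; ⌊_/2⌋)
open import Data.Nat.Properties
open import Data.Nat.DivMod using (_/_; _%_; m≡m%n+[m/n]*n; m%n<n)
open import Data.Nat.ListAction using (sum)
open import Data.Nat.Tactic.RingSolver using (solve-∀)
open import Data.Bool using (Bool; true; false; not; T; if_then_else_)
import Data.Bool.Properties as Boolₚ
open import Data.Fin using (Fin; zero; suc; toℕ; fromℕ; fromℕ<; combine; remQuot; punchOut; #_)
import Data.Fin.Properties as Finₚ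
open import Data.List using (List; []; _∷_; _++_; [_]; length; lookup; map; applyUpTo; allFin; tabulate)
open import Data.List.Properties using (length-++; length-map; map-tabulate)
open import Data.List.Membership.Propositional using (_∈_)
open import Data.List.Membership.Propositional.Properties
  using (∈-lookup; ∈-∃++; ∈-map⁺; ∈-map⁻; ∈-++⁻; ∈-++⁺ˡ; ∈-++⁺ʳ; ∈-applyUpTo⁺)
open import Data.List.Relation.Unary.All as All using (All; []; _∷_)
open import Data.List.Relation.Unary.All.Properties using (++⁺; applyUpTo⁺₂)
open import Data.List.Relation.Unary.Any using (here; there; index)
open import Data.List.Relation.Unary.Any.Properties using (lookup-index)
open import Data.List.Relation.Unary.AllPairs using ([]; _∷_)
open import Data.List.Relation.Unary.Unique.Propositional using (Unique)
import Data.List.Relation.Unary.Unique.Propositional.Properties as Uniqueₚ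
open import Data.Product using (∃-syntax; _×_; _,_; proj₁; proj₂)
open import Data.Sum using (inj₁; inj₂)
open import Data.Unit using (⊤; tt)
open import Data.Empty using (⊥-elim)
open import Function.Definitions using (Injective)
open import Relation.Binary.PropositionalEquality hiding ([_])
open import Relation.Nullary using (¬_; Dec; yes; no; isYes; _×-dec_)
open import Relation.Nullary.Decidable using (map′; toWitness; fromWitness)

lookup-injective : ∀ {A : Set} (xs : List A) → Unique xs →
  ∀ i j → lookup xs i ≡ lookup xs j → i ≡ j
lookup-injective (x ∷ xs) _ zero zero _ = refl
lookup-injective (x ∷ xs) (x∉ ∷ _) zero (suc j) e = ⊥-elim (All.lookup x∉ (∈-lookup j) e)
lookup-injective (x ∷ xs) (x∉ ∷ _) (suc i) zero e = ⊥-elim (All.lookup x∉ (∈-lookup i) (sym e))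
lookup-injective (x ∷ xs) (_ ∷ u) (suc i) (suc j) e = cong suc (lookup-injective xs u i j e)

unique-suffix : ∀ {A : Set} (as : List A) {bs : List A} → Unique (as ++ bs) → Unique bs
unique-suffix []       u       = u
unique-suffix (a ∷ as) (_ ∷ u) = unique-suffix as u

injection-bound : ∀ {D a b} (f : Fin D → Fin a × Fin b) → Injective _≡_ _≡_ f → D ≤ a * b
injection-bound f f-inj = Finₚ.injective⇒≤ combine∘f-inj
  where
  combine∘f-inj : Injective _≡_ _≡_ (λ x → combine (proj₁ (f x)) (proj₂ (f x)))
  combine∘f-inj e with Finₚ.combine-injective _ _ _ _ e
  ... | e₁ , e₂ = f-inj (cong₂ _,_ e₁ e₂)

injective⇒surjective : ∀ {m} (f : Fin m → Fin m) → Injective _≡_ _≡_ f →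
  ∀ y → ∃[ x ] f x ≡ y
injective⇒surjective {suc m} f f-inj y with Finₚ.any? (λ x → f x Finₚ.≟ y)
... | yes hit = hit
... | no miss =
  let i , j , i<j , e = Finₚ.pigeonhole ≤-refl (λ x → punchOut (avoid x))
  in ⊥-elim (Finₚ.<-irrefl (f-inj (Finₚ.punchOut-injective (avoid i) (avoid j) e)) i<j)
  where
  -- y is not hit, so f can be squeezed into Fin m
  avoid : ∀ x → y ≢ f x
  avoid x e = miss (x , sym e)

Chain : ∀ {V : Set} → (V → V → Set) → V → List V → V → Set
Chain Step u []       v = u ≡ v
Chain Step u (x ∷ xs) v = Step u x × Chain Step x xs v

chain-++ : ∀ {V : Set} {Step : V → V → Set} {u v w} xs {ys} →
  Chain Step u xs v → Chain Step v ys w → Chain Step u (xs ++ ys) w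
chain-++ []       refl       c = c
chain-++ (x ∷ xs) (s , c₁) c₂ = s , chain-++ xs c₁ c₂

chain-map : ∀ {V V' : Set} {Step : V → V → Set} {Step' : V' → V' → Set} (f : V → V') →
  (∀ {a b} → Step a b → Step' (f a) (f b)) →
  ∀ {u v} xs → Chain Step u xs v → Chain Step' (f u) (map f xs) (f v)
chain-map f step []       refl    = refl
chain-map f step (x ∷ xs) (s , c) = step s , chain-map f step xs c

chain-applyUpTo : ∀ {V : Set} {Step : V → V → Set} {x} (f : ℕ → V) m →
  Step x (f 0) → (∀ t → t < m → Step (f t) (f (suc t))) →
  Chain Step x (applyUpTo f (suc m)) (f m)
chain-applyUpTo f zero    s₀ _     = s₀ , refl
chain-applyUpTo f (suc m) s₀ steps =
  s₀ , chain-applyUpTo (λ t → f (suc t)) m (steps 0 (s≤s z≤n)) (λ t t<m → steps (suc t) (s≤s t<m))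

module WalkFacts {n : ℕ} (arc : Fin n → Fin n → Bool) (len : Fin n → Fin n → ℕ)
                 (len-pos : ∀ u v → T (arc u v) → 1 ≤ len u v) where

  open import Data.List.Membership.DecPropositional (Finₚ._≟_ {n}) using (_∈?_)

  arcs≤walkLen : ∀ {u ws v} → IsWalkFrom arc u ws v → length ws ≤ walkLen len (u ∷ ws)
  arcs≤walkLen {ws = []}     _       = z≤n
  arcs≤walkLen {u} {x ∷ xs} (a , w) = +-mono-≤ (len-pos u x a) (arcs≤walkLen w)

  walkLen-suffix : ∀ u as z bs → walkLen len (z ∷ bs) ≤ walkLen len (u ∷ as ++ z ∷ bs)
  walkLen-suffix u []       z bs = m≤n+m _ _
  walkLen-suffix u (x ∷ as) z bs = ≤-trans (walkLen-suffix x as z bs) (m≤n+m _ _)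

  walk-suffix : ∀ u as z bs {v} → IsWalkFrom arc u (as ++ z ∷ bs) v → IsWalkFrom arc z bs v
  walk-suffix u []       z bs (_ , w) = w
  walk-suffix u (x ∷ as) z bs (_ , w) = walk-suffix x as z bs w

  -- Erase the loops of the tail first; if u reappears in the
  -- result, cut everything up to that occurrence.
  erase-loops : ∀ u ws v → IsWalkFrom arc u ws v →
    ∃[ ps ] IsWalkFrom arc u ps v × Unique (u ∷ ps) × walkLen len (u ∷ ps) ≤ walkLen len (u ∷ ws)
  erase-loops u []       v w       = [] , w , [] ∷ [] , ≤-refl
  erase-loops u (x ∷ xs) v (a , w) with erase-loops x xs v w
  ... | ps , wp , up , lp with u ∈? (x ∷ ps)
  ...   | no u∉ = x ∷ ps , (a , wp) , All.tabulate (λ z∈ u≡z → u∉ (subst (_∈ _) (sym u≡z) z∈)) ∷ up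
                , +-monoʳ-≤ (len u x) lp
  ...   | yes u∈ with ∈-∃++ u∈
  ...     | [] , bs , refl = ps , wp , up , ≤-trans lp (m≤n+m _ _)
  ...     | _ ∷ as , bs , refl =
    bs , walk-suffix x as u bs wp , unique-suffix (x ∷ as) up ,
    ≤-trans (walkLen-suffix x as u bs) (≤-trans lp (m≤n+m _ _))

  -- A walk between distinct vertices has at least one arc, so its number
  -- of vertices is at most twice its length.
  vertices≤2*walkLen : ∀ {u v} W → u ≢ v → IsWalk arc u v W → length W ≤ 2 * walkLen len W
  vertices≤2*walkLen (w ∷ [])     u≢v (refl , w≡v) = ⊥-elim (u≢v w≡v)
  vertices≤2*walkLen (w ∷ x ∷ xs) _   (refl , iw)  =
    +-mono-≤ (≤-trans (s≤s z≤n) (arcs≤walkLen iw)) (≤-trans (arcs≤walkLen iw) (m≤m+n _ 0))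

  walk⇒path : ∀ u v W → IsWalk arc u v W →
    ∃[ P ] IsWalk arc u v P × Unique P × walkLen len P ≤ walkLen len W
  walk⇒path u v (w ∷ ws) (refl , iw) with erase-loops w ws v iw
  ... | ps , wp , up , lp = w ∷ ps , (refl , wp) , up , lp

  subdistance-bound : (δ : Fin n → ℕ) → (∀ u v → T (arc u v) → δ v ≤ δ u + len u v) →
    ∀ {u ws v} → IsWalkFrom arc u ws v → δ v ≤ δ u + walkLen len (u ∷ ws)
  subdistance-bound δ sub {u} {[]}     refl    = m≤m+n (δ u) 0
  subdistance-bound δ sub {u} {x ∷ xs} (a , w) = begin
    _                                 ≤⟨ subdistance-bound δ sub w ⟩
    δ x + walkLen len (x ∷ xs)        ≤⟨ +-monoˡ-≤ _ (sub u x a) ⟩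
    δ u + len u x + walkLen len (x ∷ xs) ≡⟨ +-assoc (δ u) _ _ ⟩
    δ u + walkLen len (u ∷ x ∷ xs)    ∎
    where open ≤-Reasoning

  OnTime : (Fin n → ℕ) → Fin n → Fin n → Set
  OnTime τ u v = T (arc u v) × τ v ≡ τ u + len u v

  on-time⇒walk : ∀ {τ u ws v} → Chain (OnTime τ) u ws v → IsWalkFrom arc u ws v
  on-time⇒walk {ws = []}     e             = e
  on-time⇒walk {ws = x ∷ xs} ((a , _) , c) = a , on-time⇒walk c

  on-time-prefLen : ∀ {τ u ws v} → Chain (OnTime τ) u ws v →
    ∀ j → τ u + prefLen len (u ∷ ws) j ≡ τ (lookup (u ∷ ws) j)
  on-time-prefLen             _             zero    = +-identityʳ _
  on-time-prefLen {τ} {u} {x ∷ xs} ((_ , e) , c) (suc j) = begin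
    τ u + (len u x + prefLen len (x ∷ xs) j) ≡⟨ sym (+-assoc (τ u) _ _) ⟩
    τ u + len u x + prefLen len (x ∷ xs) j   ≡⟨ cong (_+ _) (sym e) ⟩
    τ x + prefLen len (x ∷ xs) j             ≡⟨ on-time-prefLen c j ⟩
    τ (lookup (x ∷ xs) j)                    ∎
    where open ≡-Reasoning

  on-time-walkLen : ∀ {τ u ws v} → Chain (OnTime τ) u ws v → τ u + walkLen len (u ∷ ws) ≡ τ v
  on-time-walkLen {ws = []}     refl          = +-identityʳ _
  on-time-walkLen {τ} {u} {x ∷ xs} ((_ , e) , c) = begin
    τ u + (len u x + walkLen len (x ∷ xs)) ≡⟨ sym (+-assoc (τ u) _ _) ⟩
    τ u + len u x + walkLen len (x ∷ xs)   ≡⟨ cong (_+ _) (sym e) ⟩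
    τ x + walkLen len (x ∷ xs)             ≡⟨ on-time-walkLen c ⟩
    _                                      ∎
    where open ≡-Reasoning

  -- time strictly increases along it, so no vertex repeats.
  on-time-later : ∀ {τ u ws v} → Chain (OnTime τ) u ws v → All (λ z → τ u < τ z) ws
  on-time-later {ws = []}     _             = []
  on-time-later {τ} {u} {x ∷ xs} ((a , e) , c) =
    u<x ∷ All.map (<-trans u<x) (on-time-later c)
    where
    u<x : τ u < τ x
    u<x = subst (τ u <_) (sym e) (m<m+n (τ u) (len-pos u x a))

  on-time-unique : ∀ {τ u ws v} → Chain (OnTime τ) u ws v → Unique (u ∷ ws)
  on-time-unique {ws = []}     _ = [] ∷ []
  on-time-unique {τ} {ws = x ∷ xs} c@(_ , c') =
    All.map (λ lt eq → <-irrefl (cong τ eq) lt) (on-time-later c) ∷ on-time-unique c'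

sum-mono : ∀ {A : Set} {f g : A → ℕ} (xs : List A) → (∀ x → f x ≤ g x) →
  sum (map f xs) ≤ sum (map g xs)
sum-mono []       _ = z≤n
sum-mono (x ∷ xs) h = +-mono-≤ (h x) (sum-mono xs h)

sum-scale : ∀ {A : Set} (c : ℕ) (g : A → ℕ) (xs : List A) →
  sum (map (λ x → c * g x) xs) ≡ c * sum (map g xs)
sum-scale c g []       = sym (*-zeroʳ c)
sum-scale c g (x ∷ xs) = trans (cong (c * g x +_) (sum-scale c g xs)) (sym (*-distribˡ-+ c (g x) _))

module UpperBound (I : Instance) where
  open Instance I
  open WalkFacts arc len len-pos

  -- A shortest path is no longer than any walk between its ends, since
  -- the walk contains a path.
  shortest≤walk : ∀ {u v P} W → IsShortestPath I u v P → IsWalk arc u v W →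
    walkLen len P ≤ walkLen len W
  shortest≤walk {u} {v} W (_ , _ , minimal) w =
    let P' , wP' , uP' , P'≤W = walk⇒path u v W w in ≤-trans (minimal P' wP' uP') P'≤W

  module _ (d : Fin k → ℕ) (W : Fin k → List (Fin n)) (σ : Fin k → Fin k)
           (W-unique : ∀ i → Unique (W i)) where

    witness : ∀ {q x} → InB I d W σ q x → Fin k × Fin (length (W (σ q)))
    witness (h , _ , _ , j₂ , _) = h , j₂

    -- The witness determines x: the shared vertex fixes its position on the
    -- path W_h, hence x = d_h + λ(W_h, v) − λ(W_q, v).
    witness-determines : ∀ {q x y} (p : InB I d W σ q x) (p' : InB I d W σ q y) →
      witness p ≡ witness p' → x ≡ y
    witness-determines {q} {x} {y} (h , _ , j₁ , j₂ , v , e) (_ , _ , j₁' , _ , v' , e') refl =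
      +-cancelʳ-≡ _ x y (begin
        x + prefLen len (W (σ q)) j₂        ≡⟨ sym e ⟩
        d (σ h) + prefLen len (W (σ h)) j₁  ≡⟨ cong (λ j → d (σ h) + prefLen len (W (σ h)) j) same-position ⟩
        d (σ h) + prefLen len (W (σ h)) j₁' ≡⟨ e' ⟩
        y + prefLen len (W (σ q)) j₂        ∎)
      where
      open ≡-Reasoning
      same-position : j₁ ≡ j₁'
      same-position = lookup-injective (W (σ h)) (W-unique (σ h)) j₁ j₁' (trans v (sym v'))

    -- Every value below a greedy delay lies in B_q and the witnesses are
    -- distinct, so the delay is at most k · |W_q|.
    greedy-delay-bound : ∀ q → GreedyDelay I d W σ q → d (σ q) ≤ k * length (W (σ q))
    greedy-delay-bound q (_ , below) =
      injection-bound (λ x → witness (in-B x))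
        (λ e → Finₚ.toℕ-injective (witness-determines (in-B _) (in-B _) e))
      where
      in-B : (x : Fin (d (σ q))) → InB I d W σ q (toℕ x)
      in-B x = below (toℕ x) (Finₚ.toℕ<n x)

  -- Each demand of a greedy output costs at most 3k times the length of
  -- its (shortest) path:  d_i ≤ k·|W_i| ≤ 2k·λ(W_i)  and  1 ≤ k.
  demand-cost-bound : ∀ d W → AlgOutput I d W →
    ∀ i → d i + walkLen len (W i) ≤ 3 * k * walkLen len (W i)
  demand-cost-bound d W (σ , σ-inj , shortest , _ , greedy) i
    with injective⇒surjective σ σ-inj i
  ... | q , refl = begin
      d (σ q) + λq                ≤⟨ +-monoˡ-≤ λq delay≤ ⟩
      k * (2 * λq) + λq           ≤⟨ +-monoʳ-≤ (k * (2 * λq)) (m≤m*n λq k {{Finₚ.nonZeroIndex q}}) ⟩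
      k * (2 * λq) + λq * k       ≡⟨ regroup k λq ⟩
      3 * k * λq                  ∎
    where
    open ≤-Reasoning
    λq : ℕ
    λq = walkLen len (W (σ q))
    W-unique : ∀ i → Unique (W i)
    W-unique i = proj₁ (proj₂ (shortest i))
    delay≤ : d (σ q) ≤ k * (2 * λq)
    delay≤ = ≤-trans (greedy-delay-bound d W σ W-unique q (greedy q))
               (*-monoʳ-≤ k (vertices≤2*walkLen (W (σ q)) (s≢t (σ q) (σ q)) (proj₁ (shortest (σ q)))))
    regroup : ∀ k l → k * (2 * l) + l * k ≡ 3 * k * l
    regroup = solve-∀

  -- Summing over the demands: the greedy output costs at most 3k times
  -- any feasible solution, because every W'_i is a walk from s_i to t_i.
  upper-bound : ∀ d W → AlgOutput I d W → ∀ d' W' → Feasible I d' W' →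
    cost I d W ≤ 3 * k * cost I d' W'
  upper-bound d W alg@(_ , _ , shortest , _) d' W' (walks , _) = begin
    cost I d W                                                ≤⟨ sum-mono (allFin k) per-demand ⟩
    sum (map (λ i → 3 * k * (d' i + walkLen len (W' i))) (allFin k)) ≡⟨ sum-scale (3 * k) _ (allFin k) ⟩
    3 * k * cost I d' W'                                      ∎
    where
    open ≤-Reasoning
    per-demand : ∀ i → d i + walkLen len (W i) ≤ 3 * k * (d' i + walkLen len (W' i))
    per-demand i = ≤-trans (demand-cost-bound d W alg i)
      (*-monoʳ-≤ (3 * k) (≤-trans (shortest≤walk (W' i) (shortest i) (walks i)) (m≤n+m _ _)))

-- Demands of the lower-bound family come in consecutive pairs
-- q = bit q + 2 ⌊q/2⌋; the pairs alternate between the two directions.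
bit : ℕ → ℕ
bit 0             = 0
bit 1             = 1
bit (suc (suc n)) = bit n

isEven : ℕ → Bool
isEven zero    = true
isEven (suc n) = not (isEven n)

bit≤1 : ∀ n → bit n ≤ 1
bit≤1 0             = z≤n
bit≤1 1             = ≤-refl
bit≤1 (suc (suc n)) = bit≤1 n

next-pair : ∀ ε Π → ε + 2 * suc Π ≡ suc (suc (ε + 2 * Π))
next-pair = solve-∀

bit+2*half : ∀ n → n ≡ bit n + 2 * ⌊ n /2⌋
bit+2*half 0             = refl
bit+2*half 1             = refl
bit+2*half (suc (suc n)) =
  trans (cong (λ m → suc (suc m)) (bit+2*half n)) (sym (next-pair (bit n) ⌊ n /2⌋))

half-of-pair : ∀ ε Π → ε ≤ 1 → ⌊ ε + 2 * Π /2⌋ ≡ Π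
half-of-pair ε zero    (s≤s z≤n) = refl
half-of-pair ε zero    z≤n       = refl
half-of-pair ε (suc Π) ε≤1 rewrite next-pair ε Π = cong suc (half-of-pair ε Π ε≤1)

bit-of-pair : ∀ ε Π → ε ≤ 1 → bit (ε + 2 * Π) ≡ ε
bit-of-pair ε zero    (s≤s z≤n) = refl
bit-of-pair ε zero    z≤n       = refl
bit-of-pair ε (suc Π) ε≤1 rewrite next-pair ε Π = bit-of-pair ε Π ε≤1

same-pair : ∀ {h q} → h < q → ⌊ h /2⌋ ≡ ⌊ q /2⌋ → bit h < bit q
same-pair {h} {q} h<q same = +-cancelʳ-< (2 * ⌊ h /2⌋) (bit h) (bit q) (begin-strict
  bit h + 2 * ⌊ h /2⌋ ≡⟨ sym (bit+2*half h) ⟩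
  h                   <⟨ h<q ⟩
  q                   ≡⟨ bit+2*half q ⟩
  bit q + 2 * ⌊ q /2⌋ ≡⟨ cong (λ P → bit q + 2 * P) (sym same) ⟩
  bit q + 2 * ⌊ h /2⌋ ∎)
  where open ≤-Reasoning

earlier-pair : ∀ {ε Π} q → ε ≤ 1 → Π < ⌊ q /2⌋ → ε + 2 * Π < q
earlier-pair {ε} {Π} q ε≤1 Π<P = begin-strict
  ε + 2 * Π         ≤⟨ +-monoˡ-≤ (2 * Π) ε≤1 ⟩
  1 + 2 * Π         <⟨ n<1+n _ ⟩
  2 + 2 * Π         ≡⟨ sym (*-suc 2 Π) ⟩
  2 * suc Π         ≤⟨ *-monoʳ-≤ 2 Π<P ⟩
  2 * ⌊ q /2⌋       ≤⟨ m≤n+m _ (bit q) ⟩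
  bit q + 2 * ⌊ q /2⌋ ≡⟨ sym (bit+2*half q) ⟩
  q                 ∎
  where open ≤-Reasoning

-- Demand q waits delay q, then needs offset q + A time units to reach the
-- core, a path with k' arcs traversed upwards (positions 0, 1, …, k') by
-- demands with up q = true and downwards by the others.
module Timetable (k' : ℕ) where

  A : ℕ
  A = suc (suc k')

  delay : ℕ → ℕ
  delay q = ⌊ q /2⌋ * A

  offset : ℕ → ℕ
  offset q = suc (bit q)

  up : ℕ → Bool
  up q = isEven ⌊ q /2⌋

  -- how far along its traversal of the core a demand of direction b is
  -- when it is at core vertex j
  corePos : Bool → ℕ → ℕ
  corePos true  j = j
  corePos false j = k' ∸ j

  offset≤2 : ∀ q → offset q ≤ 2
  offset≤2 q = s≤s (bit≤1 q)

  later-pair-gap : ∀ {h q} → ⌊ h /2⌋ < ⌊ q /2⌋ → delay h + A ≤ delay q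
  later-pair-gap {h} {q} lt = ≤-trans (≤-reflexive (+-comm (delay h) A)) (*-monoˡ-≤ A lt)

  -- The phase delay q + offset q is strictly increasing in q; hence two
  -- demands travelling in the same direction never meet.
  phase-increasing : ∀ {h q} → h < q → delay h + offset h < delay q + offset q
  phase-increasing {h} {q} h<q with ⌊ h /2⌋ ≟ ⌊ q /2⌋
  ... | yes same rewrite same = +-monoʳ-< (delay q) (s≤s (same-pair h<q same))
  ... | no differ = begin-strict
    delay h + offset h  ≤⟨ +-monoʳ-≤ (delay h) (≤-trans (offset≤2 h) (s≤s (s≤s z≤n))) ⟩
    delay h + A         ≤⟨ later-pair-gap (≤∧≢⇒< (⌊n/2⌋-mono (<⇒≤ h<q)) differ) ⟩
    delay q             <⟨ m<m+n (delay q) (s≤s z≤n) ⟩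
    delay q + offset q  ∎
    where open ≤-Reasoning

  -- Demands of opposite directions lie in different pairs, so the later
  -- one starts at least A time units after the earlier.
  opposite-gap : ∀ {h q} → h < q → up h ≢ up q → delay h + A ≤ delay q
  opposite-gap {h} {q} h<q opposite =
    later-pair-gap (≤∧≢⇒< (⌊n/2⌋-mono (<⇒≤ h<q)) (λ same → opposite (cong isEven same)))

  -- Demand h meets demand q on the core with q delayed by x: both are at
  -- the same core vertex j at the same time (the common A cancels).
  Conflict : ℕ → ℕ → ℕ → Set
  Conflict q x h = ∃[ j ] j ≤ k' ×
    (delay h + offset h + corePos (up h) j ≡ x + offset q + corePos (up q) j)

  -- Same direction: a meeting anywhere is a meeting everywhere.
  same-direction-conflict : ∀ {q x h} → up h ≡ up q →
    delay h + offset h ≡ x + offset q → Conflict q x h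
  same-direction-conflict {q} same e rewrite same = 0 , z≤n , cong (_+ corePos (up q) 0) e

  -- Opposite directions: they meet at the core vertex where h has made a
  -- steps and q has made b = k' − a steps.
  opposite-direction-conflict : ∀ {q x h a b} → up h ≢ up q → a + b ≡ k' →
    delay h + offset h + a ≡ x + offset q + b → Conflict q x h
  opposite-direction-conflict {q} {x} {h} {a} {b} opposite a+b≡k' e with up h | up q
  ... | true  | true  = ⊥-elim (opposite refl)
  ... | false | false = ⊥-elim (opposite refl)
  ... | true  | false = a , a≤k' , trans e (cong (x + offset q +_) (sym k'∸a≡b))
    where
    a≤k' : a ≤ k'
    a≤k' = subst (a ≤_) a+b≡k' (m≤m+n a b)
    k'∸a≡b : k' ∸ a ≡ b
    k'∸a≡b = trans (cong (_∸ a) (sym a+b≡k')) (m+n∸m≡n a b)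
  ... | false | true  = b , b≤k' , trans (cong (delay h + offset h +_) k'∸b≡a) e
    where
    b≤k' : b ≤ k'
    b≤k' = subst (b ≤_) a+b≡k' (m≤n+m b a)
    k'∸b≡a : k' ∸ b ≡ a
    k'∸b≡a = trans (cong (_∸ b) (sym a+b≡k')) (m+n∸n≡m a b)

  -- Splitting an excess z ≤ 2k'+1 into a bit ε and two halves a, b with
  -- a + b = k' solves the meeting equation of an opposite pair starting at c.
  split-excess : ∀ c y z → c + suc z ≡ y + k' → z ≤ suc (k' + k') →
    ∃[ ε ] ε ≤ 1 × ∃[ a ] ∃[ b ] a + b ≡ k' × (c + suc ε + a ≡ y + b)
  split-excess c y z e z≤ =
    bit z , bit≤1 z , a , k' ∸ a , m+[n∸m]≡n a≤k' , +-cancelʳ-≡ a _ _ (begin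
      c + suc (bit z) + a + a  ≡⟨ regroup c (bit z) a ⟩
      c + suc (bit z + 2 * a)  ≡⟨ cong (λ t → c + suc t) (sym (bit+2*half z)) ⟩
      c + suc z                ≡⟨ e ⟩
      y + k'                   ≡⟨ cong (y +_) (sym (m∸n+n≡m a≤k')) ⟩
      y + (k' ∸ a + a)         ≡⟨ sym (+-assoc y (k' ∸ a) a) ⟩
      y + (k' ∸ a) + a         ∎)
    where
    open ≡-Reasoning
    a : ℕ
    a = ⌊ z /2⌋
    a≤k' : a ≤ k'
    a≤k' = ≤-trans (⌊n/2⌋-mono (≤-trans z≤ (≤-reflexive (cong suc (cong (k' +_) (sym (+-identityʳ k')))))))
                   (≤-reflexive (half-of-pair 1 k' (s≤s z≤n)))
    regroup : ∀ c e a → c + suc e + a + a ≡ c + suc (e + 2 * a)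
    regroup = solve-∀

  member-phase : ∀ ε Π → ε ≤ 1 → delay (ε + 2 * Π) + offset (ε + 2 * Π) ≡ Π * A + suc ε
  member-phase ε Π ε≤1 = cong₂ (λ P e → P * A + suc e) (half-of-pair ε Π ε≤1) (bit-of-pair ε Π ε≤1)

  member-up : ∀ ε Π → ε ≤ 1 → up (ε + 2 * Π) ≡ isEven Π
  member-up ε Π ε≤1 = cong isEven (half-of-pair ε Π ε≤1)

  -- Some member ε + 2Π of an earlier pair Π of opposite direction
  -- conflicts with q delayed by x, provided x lies in the window of length
  -- 2k' + 2 during which that pair occupies the core.
  opposite-pair-conflict : ∀ {q x Π} z → Π < ⌊ q /2⌋ → isEven Π ≢ up q →
    Π * A + suc z ≡ x + offset q + k' → z ≤ suc (k' + k') → ∃[ h ] h < q × Conflict q x h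
  opposite-pair-conflict {q} {x} {Π} z Π<P opposite e z≤ with split-excess (Π * A) (x + offset q) z e z≤
  ... | ε , ε≤1 , a , b , a+b≡k' , meet =
    ε + 2 * Π , earlier-pair q ε≤1 Π<P ,
    opposite-direction-conflict {q} {x} {ε + 2 * Π} {a} {b}
      (λ same → opposite (trans (sym (member-up ε Π ε≤1)) same))
      a+b≡k' (trans (cong (_+ a) (member-phase ε Π ε≤1)) meet)

  delayed-phase : ∀ {q x t} → x + bit q ≡ t → suc t ≡ x + offset q
  delayed-phase {q} {x} e = trans (cong suc (sym e)) (sym (+-suc x (bit q)))

  -- In the next three lemmas x + bit q = r + Π·A with r < A, i.e. q
  -- delayed by x is in phase with slot r + 1 of pair Π.

  -- Pair Π runs opposite to q: it covers x.
  opposite-block : ∀ {q x Π r} → x + bit q ≡ r + Π * A → r < A →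
    Π < ⌊ q /2⌋ → isEven Π ≢ up q → ∃[ h ] h < q × Conflict q x h
  opposite-block {q} {x} {Π} {r} decomp r<A Π<P opposite =
    opposite-pair-conflict (r + k') Π<P opposite
      (trans (regroup Π r A k') (cong (_+ k') (delayed-phase {q} decomp)))
      (+-monoˡ-≤ k' (≤-pred r<A))
    where
    regroup : ∀ Π r A k → Π * A + suc (r + k) ≡ suc (r + Π * A) + k
    regroup = solve-∀

  -- Pair Π runs like q and r ≤ 1: its member r + 2Π has exactly the phase
  -- of the delayed q, and precedes q (within q's own pair, r < bit q).
  same-block : ∀ {q x Π r} → x < delay q → x + bit q ≡ r + Π * A → Π ≤ ⌊ q /2⌋ →
    isEven Π ≡ up q → r ≤ 1 → ∃[ h ] h < q × Conflict q x h
  same-block {q} {x} {Π} {r} x<delay decomp Π≤P same r≤1 =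
    r + 2 * Π , member<q ,
    same-direction-conflict {q} {x} {r + 2 * Π} (trans (member-up r Π r≤1) same)
      (trans (member-phase r Π r≤1)
             (trans (+-suc (Π * A) r) (trans (cong suc (+-comm (Π * A) r)) (delayed-phase {q} decomp))))
    where
    member<q : r + 2 * Π < q
    member<q with Π ≟ ⌊ q /2⌋
    ... | no  Π≢P = earlier-pair q r≤1 (≤∧≢⇒< Π≤P Π≢P)
    ... | yes Π≡P = begin-strict
      r + 2 * Π           <⟨ +-monoˡ-< (2 * Π) (+-cancelʳ-< (Π * A) r (bit q) r<bit) ⟩
      bit q + 2 * Π       ≡⟨ cong (λ P → bit q + 2 * P) Π≡P ⟩
      bit q + 2 * ⌊ q /2⌋ ≡⟨ sym (bit+2*half q) ⟩
      q                   ∎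
      where
      open ≤-Reasoning
      r<bit : r + Π * A < bit q + Π * A
      r<bit = begin-strict
        r + Π * A       ≡⟨ sym decomp ⟩
        x + bit q       <⟨ +-monoˡ-< (bit q) x<delay ⟩
        delay q + bit q ≡⟨ cong (λ P → P * A + bit q) (sym Π≡P) ⟩
        Π * A + bit q   ≡⟨ +-comm (Π * A) (bit q) ⟩
        bit q + Π * A   ∎

  -- Pair Π runs like q and r ≥ 2: the next pair Π + 1 runs opposite to q,
  -- still precedes q's pair, and covers x.
  next-block : ∀ {q x Π r} → x + bit q ≡ r + Π * A → r < A → x + bit q ≤ delay q →
    isEven Π ≡ up q → ¬ r ≤ 1 → ∃[ h ] h < q × Conflict q x h
  next-block {r = 0} _ _ _ _ r≰1 = ⊥-elim (r≰1 z≤n)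
  next-block {r = 1} _ _ _ _ r≰1 = ⊥-elim (r≰1 ≤-refl)
  next-block {q} {x} {Π} {suc (suc r)} decomp r<A within same _ =
    opposite-pair-conflict r next<P next-opposite
      (trans (regroup Π r k') (cong (_+ k') (delayed-phase {q} decomp)))
      (≤-trans (<⇒≤ (≤-pred (≤-pred r<A))) (≤-trans (m≤m+n k' k') (n≤1+n _)))
    where
    open ≤-Reasoning
    regroup : ∀ Π r k → suc Π * suc (suc k) + suc r ≡ suc (suc (suc r) + Π * suc (suc k)) + k
    regroup = solve-∀
    Π<P : Π < ⌊ q /2⌋
    Π<P = *-cancelʳ-< A Π ⌊ q /2⌋ (begin-strict
      Π * A               <⟨ m<n+m (Π * A) (s≤s z≤n) ⟩
      suc (suc r) + Π * A ≡⟨ sym decomp ⟩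
      x + bit q           ≤⟨ within ⟩
      delay q             ∎)
    next-opposite : isEven (suc Π) ≢ up q
    next-opposite e = Boolₚ.not-¬ (sym same) (sym e)
    next<P : suc Π < ⌊ q /2⌋
    next<P = ≤∧≢⇒< Π<P (λ e → next-opposite (cong isEven e))

  -- Every delay x below delay q is blocked by an earlier demand meeting q
  -- on the core: decompose x + bit q by division by A and apply one of
  -- the three lemmas above.
  blocked-below-delay : ∀ q x → x < delay q → ∃[ h ] h < q × Conflict q x h
  blocked-below-delay q x x<delay = by-cases (isEven Π Boolₚ.≟ up q) (r ≤? 1)
    where
    Π r : ℕ
    Π = (x + bit q) / A
    r = (x + bit q) % A
    decomp : x + bit q ≡ r + Π * A
    decomp = m≡m%n+[m/n]*n (x + bit q) A
    r<A : r < A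
    r<A = m%n<n (x + bit q) A
    within : x + bit q ≤ delay q
    within = ≤-trans (+-monoʳ-≤ x (bit≤1 q)) (≤-trans (≤-reflexive (+-comm x 1)) x<delay)
    Π≤P : Π ≤ ⌊ q /2⌋
    Π≤P = *-cancelʳ-≤ Π ⌊ q /2⌋ A (≤-trans (m≤n+m (Π * A) r) (≤-trans (≤-reflexive (sym decomp)) within))
    by-cases : Dec (isEven Π ≡ up q) → Dec (r ≤ 1) → ∃[ h ] h < q × Conflict q x h
    by-cases (no opposite) _ =
      opposite-block {Π = Π} decomp r<A (≤∧≢⇒< Π≤P (λ e → opposite (cong isEven e))) opposite
    by-cases (yes same) (yes r≤1) = same-block {Π = Π} x<delay decomp Π≤P same r≤1
    by-cases (yes same) (no r≰1)  = next-block {Π = Π} decomp r<A within same r≰1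

count-bound : ∀ {A : Set} (P : A → Bool) (xs ys : List A) → Unique xs →
  (∀ {v} → v ∈ xs → T (P v) → v ∈ ys) →
  sum (map (λ v → if P v then 1 else 0) xs) ≤ length ys
count-bound P []       ys _          _ = z≤n
count-bound P (x ∷ xs) ys (x∉ ∷ uxs) covered with P x in Px
... | false = count-bound P xs ys uxs (λ v∈ → covered (there v∈))
... | true with ∈-∃++ (covered (here refl) (subst T (sym Px) _))
...   | as , bs , refl = begin
  suc (sum (map _ xs))       ≤⟨ s≤s (count-bound P xs (as ++ bs) uxs still-covered) ⟩
  suc (length (as ++ bs))    ≡⟨ cong suc (length-++ as) ⟩
  suc (length as + length bs) ≡⟨ sym (+-suc (length as) (length bs)) ⟩
  length as + length (x ∷ bs) ≡⟨ sym (length-++ as) ⟩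
  length (as ++ x ∷ bs)      ∎
  where
  open ≤-Reasoning
  -- the other entries are distinct from x, so they survive its removal
  still-covered : ∀ {v} → v ∈ xs → T (P v) → v ∈ as ++ bs
  still-covered {v} v∈ Pv with ∈-++⁻ as (covered (there v∈) Pv)
  ... | inj₁ v∈as         = ∈-++⁺ˡ v∈as
  ... | inj₂ (here refl)  = ⊥-elim (All.lookup x∉ v∈ refl)
  ... | inj₂ (there v∈bs) = ∈-++⁺ʳ as v∈bs

sumTo : ℕ → (ℕ → ℕ) → ℕ
sumTo zero    f = 0
sumTo (suc m) f = f 0 + sumTo m (λ t → f (suc t))

sum-tabulate : ∀ m (g : Fin m → ℕ) (f : ℕ → ℕ) → (∀ i → g i ≡ f (toℕ i)) →
  sum (tabulate g) ≡ sumTo m f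
sum-tabulate zero    g f e = refl
sum-tabulate (suc m) g f e = cong₂ _+_ (e zero) (sum-tabulate m (λ i → g (suc i)) (λ t → f (suc t)) (λ i → e (suc i)))

sum-allFin : ∀ m (g : Fin m → ℕ) (f : ℕ → ℕ) → (∀ i → g i ≡ f (toℕ i)) →
  sum (map g (allFin m)) ≡ sumTo m f
sum-allFin m g f e = trans (cong sum (map-tabulate (λ i → i) g)) (sum-tabulate m g f e)

sumTo-cong : ∀ m {f g} → (∀ t → f t ≡ g t) → sumTo m f ≡ sumTo m g
sumTo-cong zero    e = refl
sumTo-cong (suc m) e = cong₂ _+_ (e 0) (sumTo-cong m (λ t → e (suc t)))

sumTo-mono : ∀ m {f g} → (∀ t → f t ≤ g t) → sumTo m f ≤ sumTo m g
sumTo-mono zero    _ = z≤n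
sumTo-mono (suc m) h = +-mono-≤ (h 0) (sumTo-mono m (λ t → h (suc t)))

sumTo-scale : ∀ c m f → sumTo m (λ t → c * f t) ≡ c * sumTo m f
sumTo-scale c zero    f = sym (*-zeroʳ c)
sumTo-scale c (suc m) f =
  trans (cong (c * f 0 +_) (sumTo-scale c m (λ t → f (suc t)))) (sym (*-distribˡ-+ c (f 0) _))

odd-sum : ∀ m c → sumTo m (λ t → 2 * (c + t) + 1) ≡ m * m + 2 * c * m
odd-sum zero    c = sym (base c)
  where
  base : ∀ c → 0 * 0 + 2 * c * 0 ≡ 0
  base = solve-∀
odd-sum (suc m) c = begin
  2 * (c + 0) + 1 + sumTo m (λ t → 2 * (c + suc t) + 1)
    ≡⟨ cong (2 * (c + 0) + 1 +_) (sumTo-cong m (λ t → cong (λ x → 2 * x + 1) (+-suc c t))) ⟩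
  2 * (c + 0) + 1 + sumTo m (λ t → 2 * (suc c + t) + 1)
    ≡⟨ cong (2 * (c + 0) + 1 +_) (odd-sum m (suc c)) ⟩
  2 * (c + 0) + 1 + (m * m + 2 * suc c * m)
    ≡⟨ expand m c ⟩
  suc m * suc m + 2 * c * suc m ∎
  where
  open ≡-Reasoning
  expand : ∀ m c → 2 * (c + 0) + 1 + (m * m + 2 * suc c * m) ≡ suc m * suc m + 2 * c * suc m
  expand = solve-∀

sum-of-odds : ∀ m → sumTo m (λ t → 2 * t + 1) ≡ m * m
sum-of-odds m = trans (odd-sum m 0) (+-identityʳ (m * m))

module LowerBound (k' : ℕ) where

  open Timetable k'

  -- The family has k = k' + 1 demands; every path used by the algorithm
  -- has length L = 3A.
  k L : ℕ
  k = suc k'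
  L = A + A + A

  dir : Fin k → Bool
  dir i = up (toℕ i)

  -- Vertices: a source and a target per demand, an entry lane and an exit
  -- lane (each a path on k vertices) for each direction, and the core.
  data Vertex : Set where
    src tgt : Fin k → Vertex
    lane    : Bool → Fin k → Vertex
    core    : Fin k → Vertex
    exit    : Bool → Fin k → Vertex

  -- the position j on a lane or on the core (clamped to the last one)
  at : ℕ → Fin k
  at j with j <? k
  ... | yes j<k = fromℕ< j<k
  ... | no  _   = fromℕ k'

  toℕ-at : ∀ {j} → j ≤ k' → toℕ (at j) ≡ j
  toℕ-at {j} j≤k' with j <? k
  ... | yes j<k = Finₚ.toℕ-fromℕ< j<k
  ... | no  j≮k = ⊥-elim (j≮k (s≤s j≤k'))

  toℕ≤k' : ∀ (i : Fin k) → toℕ i ≤ k'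
  toℕ≤k' i = ≤-pred (Finₚ.toℕ<n i)

  corePos-involutive : ∀ b {t} → t ≤ k' → corePos b (corePos b t) ≡ t
  corePos-involutive true  _    = refl
  corePos-involutive false t≤k' = m∸[m∸n]≡n t≤k'

  corePos≤k' : ∀ b {t} → t ≤ k' → corePos b t ≤ k'
  corePos≤k' true  t≤k' = t≤k'
  corePos≤k' false {t} _ = m∸n≤m k' t

  -- A demand enters the lane of its direction at its own index,
  -- walks to the end of the lane, traverses the core in its direction,
  -- walks the exit lane up to its own index and leaves to its target; the
  -- direct arc from s_i to t_i is the alternative route.
  data Arc : Vertex → Vertex → Set where
    direct    : ∀ i → Arc (src i) (tgt i)
    enter     : ∀ i j → toℕ j ≡ toℕ i → Arc (src i) (lane (dir i) j)
    lane-step : ∀ b i j → toℕ j ≡ suc (toℕ i) → Arc (lane b i) (lane b j)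
    lane-end  : ∀ b i j → toℕ i ≡ k' → toℕ j ≡ corePos b 0 → Arc (lane b i) (core j)
    core-up   : ∀ i j → toℕ j ≡ suc (toℕ i) → Arc (core i) (core j)
    core-down : ∀ i j → toℕ i ≡ suc (toℕ j) → Arc (core i) (core j)
    core-end  : ∀ b i j → toℕ i ≡ corePos b k' → toℕ j ≡ 0 → Arc (core i) (exit b j)
    exit-step : ∀ b i j → toℕ j ≡ suc (toℕ i) → Arc (exit b i) (exit b j)
    leave     : ∀ i j → toℕ i ≡ toℕ j → Arc (exit (dir j) i) (tgt j)

  Arc? : ∀ u v → Dec (Arc u v)
  Arc? (src i) (tgt j) = map′ (λ { refl → direct i }) (λ { (direct _) → refl }) (i Finₚ.≟ j)
  Arc? (src i) (lane b j) =
    map′ (λ { (refl , e) → enter i j e }) (λ { (enter _ _ e) → refl , e })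
         ((b Boolₚ.≟ dir i) ×-dec (toℕ j ≟ toℕ i))
  Arc? (lane b i) (lane c j) =
    map′ (λ { (refl , e) → lane-step b i j e }) (λ { (lane-step _ _ _ e) → refl , e })
         ((c Boolₚ.≟ b) ×-dec (toℕ j ≟ suc (toℕ i)))
  Arc? (lane b i) (core j) =
    map′ (λ (e₁ , e₂) → lane-end b i j e₁ e₂) (λ { (lane-end _ _ _ e₁ e₂) → e₁ , e₂ })
         ((toℕ i ≟ k') ×-dec (toℕ j ≟ corePos b 0))
  Arc? (core i) (core j) with toℕ j ≟ suc (toℕ i) | toℕ i ≟ suc (toℕ j)
  ... | yes e | _     = yes (core-up i j e)
  ... | no  _ | yes e = yes (core-down i j e)
  ... | no ¬e | no ¬e' = no λ { (core-up _ _ e) → ¬e e ; (core-down _ _ e) → ¬e' e }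
  Arc? (core i) (exit b j) =
    map′ (λ (e₁ , e₂) → core-end b i j e₁ e₂) (λ { (core-end _ _ _ e₁ e₂) → e₁ , e₂ })
         ((toℕ i ≟ corePos b k') ×-dec (toℕ j ≟ 0))
  Arc? (exit b i) (exit c j) =
    map′ (λ { (refl , e) → exit-step b i j e }) (λ { (exit-step _ _ _ e) → refl , e })
         ((c Boolₚ.≟ b) ×-dec (toℕ j ≟ suc (toℕ i)))
  Arc? (exit b i) (tgt j) =
    map′ (λ { (refl , e) → leave i j e }) (λ { (leave _ _ e) → refl , e })
         ((b Boolₚ.≟ dir j) ×-dec (toℕ i ≟ toℕ j))
  Arc? (src i) (src j)    = no λ ()
  Arc? (src i) (core j)   = no λ ()
  Arc? (src i) (exit c j) = no λ ()
  Arc? (tgt i) v          = no λ ()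
  Arc? (lane b i) (src j)    = no λ ()
  Arc? (lane b i) (tgt j)    = no λ ()
  Arc? (lane b i) (exit c j) = no λ ()
  Arc? (core i) (src j)    = no λ ()
  Arc? (core i) (tgt j)    = no λ ()
  Arc? (core i) (lane c j) = no λ ()
  Arc? (exit b i) (src j)    = no λ ()
  Arc? (exit b i) (lane c j) = no λ ()
  Arc? (exit b i) (core j)   = no λ ()

  -- The last arc of demand i makes its route have length exactly L.
  exitLen : ℕ → ℕ
  exitLen i = (2 ∸ bit i) + (k' ∸ i)

  -- The direct arc has length L; the first arc of a route brings demand i
  -- to its lane position at time offset i + i + 1, its last arc has length
  -- exitLen i, and all other arcs have length 1.
  len : Vertex → Vertex → ℕ
  len (src i)    (tgt _)    = L
  len (src i)    (lane _ _) = offset (toℕ i) + suc (toℕ i)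
  len (exit _ i) (tgt _)    = exitLen (toℕ i)
  len _          _          = 1

  len-pos : ∀ {u v} → Arc u v → 1 ≤ len u v
  len-pos (direct _)           = s≤s z≤n
  len-pos (enter _ _ _)        = s≤s z≤n
  len-pos (lane-step _ _ _ _)  = ≤-refl
  len-pos (lane-end _ _ _ _ _) = ≤-refl
  len-pos (core-up _ _ _)      = ≤-refl
  len-pos (core-down _ _ _)    = ≤-refl
  len-pos (core-end _ _ _ _ _) = ≤-refl
  len-pos (exit-step _ _ _ _)  = ≤-refl
  len-pos (leave i _ _)        = ≤-trans (∸-monoʳ-≤ 2 (bit≤1 (toℕ i))) (m≤m+n _ _)

  -- The timetable of demand q: when (after its delay) q reaches each
  -- vertex of its route.  Every time except that of the source has the
  -- form offset q + (position along the route).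
  τ : Fin k → Vertex → ℕ
  τ q (src _)    = 0
  τ q (tgt _)    = L
  τ q (lane _ j) = offset (toℕ q) + suc (toℕ j)
  τ q (core j)   = offset (toℕ q) + (A + corePos (dir q) (toℕ j))
  τ q (exit _ j) = offset (toℕ q) + (A + k' + suc (toℕ j))

  exit-length : ∀ {q} → q ≤ k' → offset q + (A + k' + suc q) + exitLen q ≡ L
  exit-length {q} q≤k' = begin
    suc (bit q) + (A + k' + suc q) + ((2 ∸ bit q) + (k' ∸ q))
      ≡⟨ regroup (bit q) A k' q (2 ∸ bit q) (k' ∸ q) ⟩
    (bit q + (2 ∸ bit q)) + (q + (k' ∸ q)) + A + k' + 2
      ≡⟨ cong₂ (λ x y → x + y + A + k' + 2) (m+[n∸m]≡n (≤-trans (bit≤1 q) (n≤1+n 1))) (m+[n∸m]≡n q≤k') ⟩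
    2 + k' + A + k' + 2
      ≡⟨ three-blocks k' ⟩
    L ∎
    where
    open ≡-Reasoning
    regroup : ∀ b a k q x y → suc b + (a + k + suc q) + (x + y) ≡ (b + x) + (q + y) + a + k + 2
    regroup = solve-∀
    three-blocks : ∀ k → 2 + k + suc (suc k) + k + 2 ≡ suc (suc k) + suc (suc k) + suc (suc k)
    three-blocks = solve-∀

  τ-core : ∀ q {t} → t ≤ k' → τ q (core (at (corePos (dir q) t))) ≡ offset (toℕ q) + (A + t)
  τ-core q {t} t≤k' rewrite toℕ-at (corePos≤k' (dir q) t≤k') | corePos-involutive (dir q) t≤k' = refl

  tick : ∀ a x → a + suc x ≡ a + x + 1
  tick a x = trans (+-suc a x) (+-comm 1 (a + x))

  tick-inside : ∀ a b x → a + (b + suc x) ≡ a + (b + x) + 1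
  tick-inside a b x = trans (cong (a +_) (tick b x)) (sym (+-assoc a (b + x) 1))

  τ-enter : ∀ q {b j} → toℕ j ≡ toℕ q → τ q (lane b j) ≡ τ q (src q) + len (src q) (lane b j)
  τ-enter q e = cong (λ p → offset (toℕ q) + suc p) e

  τ-lane-step : ∀ q {b i j} → toℕ j ≡ suc (toℕ i) → τ q (lane b j) ≡ τ q (lane b i) + 1
  τ-lane-step q {i = i} e = trans (cong (λ p → offset (toℕ q) + suc p) e) (tick (offset (toℕ q)) (suc (toℕ i)))

  τ-core-entry : ∀ q {b i j} → toℕ i ≡ k' → toℕ j ≡ corePos (dir q) 0 → τ q (core j) ≡ τ q (lane b i) + 1
  τ-core-entry q {i = i} {j} e₁ e₂ = begin
    o + (A + corePos (dir q) (toℕ j))             ≡⟨ cong (λ p → o + (A + corePos (dir q) p)) e₂ ⟩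
    o + (A + corePos (dir q) (corePos (dir q) 0)) ≡⟨ cong (λ p → o + (A + p)) (corePos-involutive (dir q) z≤n) ⟩
    o + (A + 0)                                   ≡⟨ cong (o +_) (+-identityʳ A) ⟩
    o + suc (suc k')                              ≡⟨ tick o (suc k') ⟩
    o + suc k' + 1                                ≡⟨ cong (λ p → o + suc p + 1) (sym e₁) ⟩
    o + suc (toℕ i) + 1                           ∎
    where
    open ≡-Reasoning
    o : ℕ
    o = offset (toℕ q)

  τ-core-exit : ∀ q {b i j} → toℕ i ≡ corePos (dir q) k' → toℕ j ≡ 0 → τ q (exit b j) ≡ τ q (core i) + 1
  τ-core-exit q {i = i} {j} e₁ e₂ = begin
    o + (A + k' + suc (toℕ j))                         ≡⟨ cong (λ p → o + (A + k' + suc p)) e₂ ⟩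
    o + (A + k' + 1)                                   ≡⟨ sym (+-assoc o (A + k') 1) ⟩
    o + (A + k') + 1                                   ≡⟨ cong (λ p → o + (A + p) + 1) (sym (corePos-involutive (dir q) ≤-refl)) ⟩
    o + (A + corePos (dir q) (corePos (dir q) k')) + 1 ≡⟨ cong (λ p → o + (A + corePos (dir q) p) + 1) (sym e₁) ⟩
    o + (A + corePos (dir q) (toℕ i)) + 1              ∎
    where
    open ≡-Reasoning
    o : ℕ
    o = offset (toℕ q)

  τ-exit-step : ∀ q {b i j} → toℕ j ≡ suc (toℕ i) → τ q (exit b j) ≡ τ q (exit b i) + 1
  τ-exit-step q {i = i} e =
    trans (cong (λ p → offset (toℕ q) + (A + k' + suc p)) e) (tick-inside (offset (toℕ q)) (A + k') (suc (toℕ i)))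

  τ-leave : ∀ q {b i} → toℕ i ≡ toℕ q → τ q (tgt q) ≡ τ q (exit b i) + len (exit b i) (tgt q)
  τ-leave q e = sym (trans (cong (λ p → offset (toℕ q) + (A + k' + suc p) + exitLen p) e) (exit-length (toℕ≤k' q)))

  next-position : ∀ {p} → suc p ≤ k' → toℕ (at (suc p)) ≡ suc (toℕ (at p))
  next-position sp≤k' = trans (toℕ-at sp≤k') (cong suc (sym (toℕ-at (<⇒≤ sp≤k'))))

  core-arc : ∀ b t → t < k' → Arc (core (at (corePos b t))) (core (at (corePos b (suc t))))
  core-arc true  t t<k' = core-up _ _ (next-position t<k')
  core-arc false t t<k' =
    core-down _ _ (trans (cong (λ p → toℕ (at p)) k'∸t≡) (next-position (subst (_≤ k') k'∸t≡ (m∸n≤m k' t))))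
    where
    k'∸t≡ : k' ∸ t ≡ suc (k' ∸ suc t)
    k'∸t≡ = +-∸-assoc 1 t<k'

  lanePart corePart exitPart : Fin k → List Vertex
  lanePart q = applyUpTo (λ t → lane (dir q) (at (t + toℕ q))) (suc (k' ∸ toℕ q))
  corePart q = applyUpTo (λ t → core (at (corePos (dir q) t))) (suc k')
  exitPart q = applyUpTo (λ t → exit (dir q) (at t)) (suc (toℕ q))

  route : Fin k → List Vertex
  route q = src q ∷ lanePart q ++ corePart q ++ exitPart q ++ [ tgt q ]

  Step : Fin k → Vertex → Vertex → Set
  Step q u v = Arc u v × τ q v ≡ τ q u + len u v

  lane-end≡k' : ∀ q → toℕ (at ((k' ∸ toℕ q) + toℕ q)) ≡ k'
  lane-end≡k' q = trans (toℕ-at (≤-reflexive (m∸n+n≡m (toℕ≤k' q)))) (m∸n+n≡m (toℕ≤k' q))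

  lane-on-time : ∀ q → Chain (Step q) (src q) (lanePart q) (lane (dir q) (at ((k' ∸ toℕ q) + toℕ q)))
  lane-on-time q = chain-applyUpTo (λ t → lane (dir q) (at (t + toℕ q))) (k' ∸ toℕ q) first step
    where
    start : toℕ (at (toℕ q)) ≡ toℕ q
    start = toℕ-at (toℕ≤k' q)
    first : Step q (src q) (lane (dir q) (at (toℕ q)))
    first = enter q _ start , τ-enter q {dir q} start
    step : ∀ t → t < k' ∸ toℕ q → Step q (lane (dir q) (at (t + toℕ q))) (lane (dir q) (at (suc t + toℕ q)))
    step t t< = lane-step (dir q) _ _ next , τ-lane-step q {dir q} next
      where
      next : toℕ (at (suc t + toℕ q)) ≡ suc (toℕ (at (t + toℕ q)))
      next = next-position (≤-trans (+-monoˡ-≤ (toℕ q) t<) (≤-reflexive (m∸n+n≡m (toℕ≤k' q))))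

  core-on-time : ∀ q →
    Chain (Step q) (lane (dir q) (at ((k' ∸ toℕ q) + toℕ q))) (corePart q) (core (at (corePos (dir q) k')))
  core-on-time q = chain-applyUpTo (λ t → core (at (corePos (dir q) t))) k' first step
    where
    entry : toℕ (at (corePos (dir q) 0)) ≡ corePos (dir q) 0
    entry = toℕ-at (corePos≤k' (dir q) z≤n)
    first : Step q (lane (dir q) (at ((k' ∸ toℕ q) + toℕ q))) (core (at (corePos (dir q) 0)))
    first = lane-end (dir q) _ _ (lane-end≡k' q) entry , τ-core-entry q {dir q} (lane-end≡k' q) entry
    step : ∀ t → t < k' → Step q (core (at (corePos (dir q) t))) (core (at (corePos (dir q) (suc t))))
    step t t<k' = core-arc (dir q) t t<k' ,
      trans (τ-core q t<k') (trans (tick-inside (offset (toℕ q)) A t) (cong (_+ 1) (sym (τ-core q (<⇒≤ t<k')))))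

  exit-on-time : ∀ q → Chain (Step q) (core (at (corePos (dir q) k'))) (exitPart q ++ [ tgt q ]) (tgt q)
  exit-on-time q =
    chain-++ (exitPart q) (chain-applyUpTo (λ t → exit (dir q) (at t)) (toℕ q) first step) (last , refl)
    where
    leaving : toℕ (at (corePos (dir q) k')) ≡ corePos (dir q) k'
    leaving = toℕ-at (corePos≤k' (dir q) ≤-refl)
    first : Step q (core (at (corePos (dir q) k'))) (exit (dir q) (at 0))
    first = core-end (dir q) _ _ leaving (toℕ-at z≤n) , τ-core-exit q {dir q} leaving (toℕ-at z≤n)
    step : ∀ t → t < toℕ q → Step q (exit (dir q) (at t)) (exit (dir q) (at (suc t)))
    step t t<q = exit-step (dir q) _ _ next , τ-exit-step q {dir q} next
      where
      next : toℕ (at (suc t)) ≡ suc (toℕ (at t))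
      next = next-position (≤-trans t<q (toℕ≤k' q))
    last : Step q (exit (dir q) (at (toℕ q))) (tgt q)
    last = leave _ q (toℕ-at (toℕ≤k' q)) , τ-leave q {dir q} (toℕ-at (toℕ≤k' q))

  route-on-time : ∀ q → Chain (Step q) (src q) (lanePart q ++ corePart q ++ exitPart q ++ [ tgt q ]) (tgt q)
  route-on-time q =
    chain-++ (lanePart q) (lane-on-time q) (chain-++ (corePart q) (core-on-time q) (exit-on-time q))

  n : ℕ
  n = 7 * k

  code : Vertex → Fin 7 × Fin k
  code (src i)        = # 0 , i
  code (tgt i)        = # 1 , i
  code (lane true i)  = # 2 , i
  code (lane false i) = # 3 , i
  code (core i)       = # 4 , i
  code (exit true i)  = # 5 , i
  code (exit false i) = # 6 , i

  decode : Fin 7 × Fin k → Vertex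
  decode (zero , i)                                     = src i
  decode (suc zero , i)                                 = tgt i
  decode (suc (suc zero) , i)                           = lane true i
  decode (suc (suc (suc zero)) , i)                     = lane false i
  decode (suc (suc (suc (suc zero))) , i)               = core i
  decode (suc (suc (suc (suc (suc zero)))) , i)         = exit true i
  decode (suc (suc (suc (suc (suc (suc zero))))) , i)   = exit false i

  decode-code : ∀ v → decode (code v) ≡ v
  decode-code (src i)        = refl
  decode-code (tgt i)        = refl
  decode-code (lane true i)  = refl
  decode-code (lane false i) = refl
  decode-code (core i)       = refl
  decode-code (exit true i)  = refl
  decode-code (exit false i) = refl

  code-decode : ∀ c i → code (decode (c , i)) ≡ (c , i)
  code-decode zero                                     i = refl
  code-decode (suc zero)                               i = refl
  code-decode (suc (suc zero))                         i = refl
  code-decode (suc (suc (suc zero)))                   i = refl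
  code-decode (suc (suc (suc (suc zero))))             i = refl
  code-decode (suc (suc (suc (suc (suc zero)))))       i = refl
  code-decode (suc (suc (suc (suc (suc (suc zero)))))) i = refl

  enc : Vertex → Fin n
  enc v = combine (proj₁ (code v)) (proj₂ (code v))

  dec : Fin n → Vertex
  dec u = decode (remQuot k u)

  dec-enc : ∀ v → dec (enc v) ≡ v
  dec-enc v = trans (cong decode (Finₚ.remQuot-combine (proj₁ (code v)) (proj₂ (code v)))) (decode-code v)

  enc-dec : ∀ u → enc (dec u) ≡ u
  enc-dec u = trans (enc-decode (remQuot k u)) (Finₚ.combine-remQuot {7} k u)
    where
    enc-decode : ∀ p → enc (decode p) ≡ combine (proj₁ p) (proj₂ p)
    enc-decode (c , i) = cong (λ p → combine (proj₁ p) (proj₂ p)) (code-decode c i)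

  enc-injective : ∀ {v w} → enc v ≡ enc w → v ≡ w
  enc-injective {v} {w} e = trans (sym (dec-enc v)) (trans (cong dec e) (dec-enc w))

  arcN : Fin n → Fin n → Bool
  arcN u v = isYes (Arc? (dec u) (dec v))

  lenN : Fin n → Fin n → ℕ
  lenN u v = len (dec u) (dec v)

  arc-sound : ∀ {u v} → T (arcN u v) → Arc (dec u) (dec v)
  arc-sound = toWitness

  arc-complete : ∀ {u v} → Arc u v → T (arcN (enc u) (enc v))
  arc-complete {u} {v} a rewrite dec-enc u | dec-enc v = fromWitness a

  len-posN : ∀ u v → T (arcN u v) → 1 ≤ lenN u v
  len-posN u v a = len-pos (arc-sound {u} {v} a)

  open WalkFacts arcN lenN len-posN

  τN : Fin k → Fin n → ℕ
  τN q u = τ q (dec u)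

  τN-enc : ∀ q v → τN q (enc v) ≡ τ q v
  τN-enc q v = cong (τ q) (dec-enc v)

  encode-step : ∀ {q u v} → Step q u v → OnTime (τN q) (enc u) (enc v)
  encode-step {q} {u} {v} (a , e) rewrite dec-enc u | dec-enc v = fromWitness a , e

  W : Fin k → List (Fin n)
  W q = map enc (route q)

  W-on-time : ∀ q → Chain (OnTime (τN q)) (enc (src q))
    (map enc (lanePart q ++ corePart q ++ exitPart q ++ [ tgt q ])) (enc (tgt q))
  W-on-time q = chain-map enc encode-step _ (route-on-time q)

  W-walk : ∀ q → IsWalk arcN (enc (src q)) (enc (tgt q)) (W q)
  W-walk q = refl , on-time⇒walk {τN q} {enc (src q)} (W-on-time q)

  W-unique : ∀ q → Unique (W q)
  W-unique q = on-time-unique {τN q} {enc (src q)} (W-on-time q)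

  W-length : ∀ q → walkLen lenN (W q) ≡ L
  W-length q = trans (cong (_+ walkLen lenN (W q)) (sym (τN-enc q (src q))))
                     (trans (on-time-walkLen {τN q} {enc (src q)} (W-on-time q)) (τN-enc q (tgt q)))

  W-prefLen : ∀ q j → prefLen lenN (W q) j ≡ τN q (lookup (W q) j)
  W-prefLen q j = trans (cong (_+ prefLen lenN (W q) j) (sym (τN-enc q (src q))))
                        (on-time-prefLen {τN q} {enc (src q)} (W-on-time q) j)

  family : Instance
  family = record
    { n = n ; arc = arcN ; len = lenN ; len-pos = len-posN ; k = k
    ; s = λ i → enc (src i) ; t = λ i → enc (tgt i)
    ; s-inj = λ i j e → src-injective (enc-injective e)
    ; t-inj = λ i j e → tgt-injective (enc-injective e)
    ; s≢t = λ i j e → src≢tgt (enc-injective e)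
    ; reach = λ q → W q , W-walk q }
    where
    src-injective : ∀ {i j} → src i ≡ src j → i ≡ j
    src-injective refl = refl
    tgt-injective : ∀ {i j} → tgt i ≡ tgt j → i ≡ j
    tgt-injective refl = refl
    src≢tgt : ∀ {i j} → src i ≢ tgt j
    src≢tgt ()

  before-L : ∀ q {X} → X ≤ A + (k' + suc k') → offset q + X ≤ L
  before-L q X≤ = ≤-trans (+-mono-≤ (offset≤2 q) X≤) (≤-trans (n≤1+n _) (≤-reflexive (room k')))
    where
    room : ∀ k → suc (2 + (suc (suc k) + (k + suc k))) ≡ suc (suc k) + suc (suc k) + suc (suc k)
    room = solve-∀

  τ-lane≤L : ∀ q b j → τ q (lane b j) ≤ L
  τ-lane≤L q b j = before-L (toℕ q) (≤-trans (s≤s (toℕ≤k' j)) (≤-trans (n≤1+n _) (m≤m+n A _)))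

  τ-core≤L : ∀ q j → τ q (core j) ≤ L
  τ-core≤L q j = before-L (toℕ q) (+-monoʳ-≤ A (≤-trans (corePos≤k' (dir q) (toℕ≤k' j)) (m≤m+n k' _)))

  -- A sub-distance towards t_q: q's timetable on the vertices q can use,
  -- L on the other sources and on the lanes of the other direction, and 0
  -- on the other targets and on the exit lane of the other direction.
  δ : Fin k → Vertex → ℕ
  δ q (src i)    = if isYes (i Finₚ.≟ q) then 0 else L
  δ q (tgt i)    = if isYes (i Finₚ.≟ q) then L else 0
  δ q (lane b j) = if isYes (b Boolₚ.≟ dir q) then τ q (lane b j) else L
  δ q (core j)   = τ q (core j)
  δ q (exit b j) = if isYes (b Boolₚ.≟ dir q) then τ q (exit b j) else 0

  one-step : ∀ a {x y} → x ≤ suc y → a + x ≤ a + y + 1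
  one-step a {x} {y} x≤ = ≤-trans (+-monoʳ-≤ a x≤) (≤-reflexive (tick a y))

  corePos-forward : ∀ b x → corePos b (suc x) ≤ suc (corePos b x)
  corePos-forward true  x = ≤-refl
  corePos-forward false x = ≤-trans (∸-monoʳ-≤ k' (n≤1+n x)) (n≤1+n _)

  corePos-backward : ∀ b x → corePos b x ≤ suc (corePos b (suc x))
  corePos-backward true  x = ≤-trans (n≤1+n x) (n≤1+n _)
  corePos-backward false x = ∸-step k' x
    where
    ∸-step : ∀ m x → m ∸ x ≤ suc (m ∸ suc x)
    ∸-step zero    zero    = z≤n
    ∸-step zero    (suc x) = z≤n
    ∸-step (suc m) zero    = ≤-refl
    ∸-step (suc m) (suc x) = ∸-step m x

  core-one-step : ∀ q {i j} → corePos (dir q) (toℕ j) ≤ suc (corePos (dir q) (toℕ i)) →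
    τ q (core j) ≤ τ q (core i) + 1
  core-one-step q h = one-step (offset (toℕ q)) (≤-trans (+-monoʳ-≤ A h) (≤-reflexive (+-suc A _)))

  δ-lane≤L : ∀ q b j → δ q (lane b j) ≤ L
  δ-lane≤L q b j with b Boolₚ.≟ dir q
  ... | yes _ = τ-lane≤L q b j
  ... | no  _ = ≤-refl

  -- δ q is a sub-distance: it grows by at most the length of every arc.
  -- On the arcs q can use, this is its timetable; elsewhere δ q is L
  -- before, or 0 after, the arc.
  δ-sub : ∀ q {u v} → Arc u v → δ q v ≤ δ q u + len u v
  δ-sub q (direct i) with i Finₚ.≟ q
  ... | yes _ = ≤-refl
  ... | no  _ = z≤n
  δ-sub q (enter i j e) with i Finₚ.≟ q
  ... | no  _    = ≤-trans (δ-lane≤L q (dir i) j) (m≤m+n L _)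
  ... | yes refl with dir q Boolₚ.≟ dir q
  ...   | yes _  = ≤-reflexive (τ-enter q {dir q} e)
  ...   | no  ne = ⊥-elim (ne refl)
  δ-sub q (lane-step b i j e) with b Boolₚ.≟ dir q
  ... | yes _ = ≤-reflexive (τ-lane-step q {b} e)
  ... | no  _ = m≤m+n L 1
  δ-sub q (lane-end b i j e₁ e₂) with b Boolₚ.≟ dir q
  ... | yes refl = ≤-reflexive (τ-core-entry q {dir q} e₁ e₂)
  ... | no  _    = ≤-trans (τ-core≤L q j) (m≤m+n L 1)
  δ-sub q (core-up i j e) =
    core-one-step q (subst (λ p → corePos (dir q) p ≤ _) (sym e) (corePos-forward (dir q) (toℕ i)))
  δ-sub q (core-down i j e) =
    core-one-step q (subst (λ p → _ ≤ suc (corePos (dir q) p)) (sym e) (corePos-backward (dir q) (toℕ j)))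
  δ-sub q (core-end b i j e₁ e₂) with b Boolₚ.≟ dir q
  ... | yes refl = ≤-reflexive (τ-core-exit q {dir q} e₁ e₂)
  ... | no  _    = z≤n
  δ-sub q (exit-step b i j e) with b Boolₚ.≟ dir q
  ... | yes _ = ≤-reflexive (τ-exit-step q {b} e)
  ... | no  _ = z≤n
  δ-sub q (leave i j e) with j Finₚ.≟ q
  ... | no  _    = z≤n
  ... | yes refl with dir q Boolₚ.≟ dir q
  ...   | yes _  = ≤-reflexive (τ-leave q {dir q} e)
  ...   | no  ne = ⊥-elim (ne refl)

  δ-src : ∀ q → δ q (src q) ≡ 0
  δ-src q with q Finₚ.≟ q
  ... | yes _ = refl
  ... | no ne = ⊥-elim (ne refl)

  δ-tgt : ∀ q → δ q (tgt q) ≡ L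
  δ-tgt q with q Finₚ.≟ q
  ... | yes _ = refl
  ... | no ne = ⊥-elim (ne refl)

  walk-length-bound : ∀ q W' → IsWalk arcN (enc (src q)) (enc (tgt q)) W' → L ≤ walkLen lenN W'
  walk-length-bound q (w ∷ ws) (refl , walk) =
    subst₂ _≤_ (trans (cong (δ q) (dec-enc (tgt q))) (δ-tgt q))
               (cong (_+ walkLen lenN (w ∷ ws)) (trans (cong (δ q) (dec-enc (src q))) (δ-src q)))
      (subdistance-bound (λ u → δ q (dec u)) (λ u v a → δ-sub q (arc-sound {u} {v} a)) walk)

  W-shortest : ∀ q → IsShortestPath family (enc (src q)) (enc (tgt q)) (W q)
  W-shortest q = W-walk q , W-unique q ,
    λ P walk _ → subst (_≤ walkLen lenN P) (sym (W-length q)) (walk-length-bound q P walk)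

  OnRoute : Fin k → Vertex → Set
  OnRoute q (src i)    = i ≡ q
  OnRoute q (tgt i)    = i ≡ q
  OnRoute q (lane b _) = b ≡ dir q
  OnRoute q (core _)   = ⊤
  OnRoute q (exit b _) = b ≡ dir q

  route-on-route : ∀ q → All (OnRoute q) (route q)
  route-on-route q = refl ∷ ++⁺ on-lane (++⁺ on-core (++⁺ on-exit (refl ∷ [])))
    where
    on-lane : All (OnRoute q) (lanePart q)
    on-lane = applyUpTo⁺₂ (λ t → lane (dir q) (at (t + toℕ q))) _ (λ _ → refl)
    on-core : All (OnRoute q) (corePart q)
    on-core = applyUpTo⁺₂ (λ t → core (at (corePos (dir q) t))) _ (λ _ → tt)
    on-exit : All (OnRoute q) (exitPart q)
    on-exit = applyUpTo⁺₂ (λ t → exit (dir q) (at t)) _ (λ _ → refl)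

  core-on-route : ∀ q {j} → j ≤ k' → core (at j) ∈ route q
  core-on-route q {j} j≤k' = there (∈-++⁺ʳ (lanePart q) (∈-++⁺ˡ on-core))
    where
    on-core : core (at j) ∈ corePart q
    on-core = subst (_∈ corePart q) (cong (λ p → core (at p)) (corePos-involutive (dir q) j≤k'))
      (∈-applyUpTo⁺ (λ t → core (at (corePos (dir q) t))) (s≤s (corePos≤k' (dir q) j≤k')))

  on-route-at : ∀ q j → OnRoute q (dec (lookup (W q) j))
  on-route-at q j with ∈-map⁻ enc (∈-lookup {xs = W q} j)
  ... | v , v∈ , e = subst (OnRoute q) (sym (trans (cong dec e) (dec-enc v))) (All.lookup (route-on-route q) v∈)

  position : ∀ q {v} → v ∈ route q →
    ∃[ j ] lookup (W q) j ≡ enc v × prefLen lenN (W q) j ≡ τ q v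
  position q {v} v∈ =
    index p , sym (lookup-index p) ,
    trans (W-prefLen q (index p)) (trans (cong (τN q) (sym (lookup-index p))) (τN-enc q v))
    where
    p : enc v ∈ W q
    p = ∈-map⁺ enc v∈

  -- With the delays of the timetable, a demand h earlier than q is at every
  -- common vertex strictly before q: in the same direction its phase is
  -- smaller, in the opposite direction it has left the core before q enters.
  phase-shift : ∀ {h q} → h < q → ∀ X → delay h + (offset h + X) < delay q + (offset q + X)
  phase-shift {h} {q} h<q X =
    subst₂ _<_ (+-assoc (delay h) (offset h) X) (+-assoc (delay q) (offset q) X)
      (+-monoˡ-< X (phase-increasing h<q))

  opposite-shift : ∀ {h q c c'} → delay h + A ≤ delay q → offset h + c ≤ A →
    delay h + (offset h + (A + c)) < delay q + (offset q + (A + c'))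
  opposite-shift {h} {q} {c} {c'} gap short = begin-strict
    delay h + (offset h + (A + c)) ≡⟨ regroup (delay h) (offset h) A c ⟩
    (delay h + A) + (offset h + c) ≤⟨ +-mono-≤ gap short ⟩
    delay q + A                    <⟨ +-monoʳ-< (delay q) (m<n+m A (s≤s z≤n)) ⟩
    delay q + (offset q + A)       ≤⟨ +-monoʳ-≤ (delay q) (+-monoʳ-≤ (offset q) (m≤m+n A c')) ⟩
    delay q + (offset q + (A + c')) ∎
    where
    open ≤-Reasoning
    regroup : ∀ d o a c → d + (o + (a + c)) ≡ (d + a) + (o + c)
    regroup = solve-∀

  separated : ∀ {h q} v → toℕ h < toℕ q → OnRoute h v → OnRoute q v →
    delay (toℕ h) + τ h v < delay (toℕ q) + τ q v
  separated (src i)    h<q refl refl = ⊥-elim (<-irrefl refl h<q)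
  separated (tgt i)    h<q refl refl = ⊥-elim (<-irrefl refl h<q)
  separated (lane b j) h<q _    _    = phase-shift h<q (suc (toℕ j))
  separated (exit b j) h<q _    _    = phase-shift h<q (A + k' + suc (toℕ j))
  separated {h} {q} (core j) h<q _ _ with dir h Boolₚ.≟ dir q
  ... | yes same rewrite same = phase-shift h<q (A + corePos (dir q) (toℕ j))
  ... | no opposite = opposite-shift {toℕ h} {toℕ q} (opposite-gap h<q opposite)
                        (+-mono-≤ (offset≤2 (toℕ h)) (corePos≤k' (dir h) (toℕ≤k' j)))

  delays : Fin k → ℕ
  delays q = delay (toℕ q)

  no-earlier-conflict : ∀ i → ¬ InB family delays W (λ q → q) i (delays i)
  no-earlier-conflict i (h , h<i , j₁ , j₂ , same , e) =
    <-irrefl meet (separated v h<i (on-route-at h j₁) on-i)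
    where
    v : Vertex
    v = dec (lookup (W h) j₁)
    on-i : OnRoute i v
    on-i = subst (OnRoute i) (cong dec (sym same)) (on-route-at i j₂)
    meet : delay (toℕ h) + τ h v ≡ delay (toℕ i) + τ i v
    meet = trans (cong (delays h +_) (sym (W-prefLen h j₁)))
             (trans e (cong (delays i +_) (trans (W-prefLen i j₂) (cong (λ u → τ i (dec u)) (sym same)))))

  meeting-time : ∀ {h i : Fin k} {x j} → j ≤ k' →
    delay (toℕ h) + offset (toℕ h) + corePos (dir h) j ≡ x + offset (toℕ i) + corePos (dir i) j →
    delay (toℕ h) + τ h (core (at j)) ≡ x + τ i (core (at j))
  meeting-time {h} {i} {x} {j} j≤k' e rewrite toℕ-at j≤k' =
    trans (regroup (delay (toℕ h)) (offset (toℕ h)) A (corePos (dir h) j))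
      (trans (cong (_+ A) e) (sym (regroup x (offset (toℕ i)) A (corePos (dir i) j))))
    where
    regroup : ∀ d o a c → d + (o + (a + c)) ≡ d + o + c + a
    regroup = solve-∀

  core-meeting⇒InB : ∀ {h i : Fin k} {x j} → toℕ h < toℕ i → j ≤ k' →
    delays h + τ h (core (at j)) ≡ x + τ i (core (at j)) → InB family delays W (λ q → q) i x
  core-meeting⇒InB {h} {i} {x} h<i j≤k' meet
    with position h (core-on-route h j≤k') | position i (core-on-route i j≤k')
  ... | j₁ , l₁ , p₁ | j₂ , l₂ , p₂ =
    h , h<i , j₁ , j₂ , trans l₁ (sym l₂) ,
    trans (cong (delays h +_) p₁) (trans meet (cong (x +_) (sym p₂)))

  all-blocked : ∀ i x → x < delays i → InB family delays W (λ q → q) i x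
  all-blocked i x x<delay with blocked-below-delay (toℕ i) x x<delay
  ... | h' , h'<i , j , j≤k' , e =
    core-meeting⇒InB {h} {i} (subst (_< toℕ i) (sym toℕ-h) h'<i) j≤k'
      (meeting-time {h} {i} j≤k' (subst (λ m → delay m + offset m + corePos (up m) j ≡ _) (sym toℕ-h) e))
    where
    h : Fin k
    h = fromℕ< (<-trans h'<i (Finₚ.toℕ<n i))
    toℕ-h : toℕ h ≡ h'
    toℕ-h = Finₚ.toℕ-fromℕ< _

  greedy-output : AlgOutput family delays W
  greedy-output = (λ q → q) , (λ e → e) , W-shortest ,
    (λ i j _ → ≤-reflexive (trans (W-length i) (sym (W-length j)))) ,
    (λ i → no-earlier-conflict i , all-blocked i)

  is-at : ∀ {j : Fin k} {p} → toℕ j ≡ p → j ≡ at p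
  is-at {j} refl = Finₚ.toℕ-injective (sym (toℕ-at (toℕ≤k' j)))

  next prev : Fin k → Fin k
  next i = at (suc (toℕ i))
  prev i = at (toℕ i ∸ 1)

  outs ins : Vertex → List Vertex
  outs (src i)    = tgt i ∷ lane (dir i) i ∷ []
  outs (tgt i)    = []
  outs (lane b i) = lane b (next i) ∷ core (at (corePos b 0)) ∷ []
  outs (core i)   = core (next i) ∷ core (prev i) ∷ exit true (at 0) ∷ exit false (at 0) ∷ []
  outs (exit b i) = exit b (next i) ∷ tgt i ∷ []
  ins (src i)     = []
  ins (tgt i)     = src i ∷ exit true i ∷ exit false i ∷ []
  ins (lane b i)  = lane b (prev i) ∷ src i ∷ []
  ins (core i)    = core (next i) ∷ core (prev i) ∷ lane true (at k') ∷ lane false (at k') ∷ []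
  ins (exit b i)  = exit b (prev i) ∷ core (at (corePos b k')) ∷ []

  outs≤4 : ∀ v → length (outs v) ≤ 4
  outs≤4 (src i)    = s≤s (s≤s z≤n)
  outs≤4 (tgt i)    = z≤n
  outs≤4 (lane b i) = s≤s (s≤s z≤n)
  outs≤4 (core i)   = ≤-refl
  outs≤4 (exit b i) = s≤s (s≤s z≤n)

  ins≤4 : ∀ v → length (ins v) ≤ 4
  ins≤4 (src i)    = z≤n
  ins≤4 (tgt i)    = s≤s (s≤s (s≤s z≤n))
  ins≤4 (lane b i) = s≤s (s≤s z≤n)
  ins≤4 (core i)   = ≤-refl
  ins≤4 (exit b i) = s≤s (s≤s z≤n)

  is-prev : ∀ {i j : Fin k} → toℕ j ≡ suc (toℕ i) → i ≡ prev j
  is-prev e = is-at (sym (cong (_∸ 1) e))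

  outs-complete : ∀ {u v} → Arc u v → v ∈ outs u
  outs-complete (direct i)               = here refl
  outs-complete (enter i j e)            = there (here (cong (lane (dir i)) (Finₚ.toℕ-injective e)))
  outs-complete (lane-step b i j e)      = here (cong (lane b) (is-at e))
  outs-complete (lane-end b i j _ e)     = there (here (cong core (is-at e)))
  outs-complete (core-up i j e)          = here (cong core (is-at e))
  outs-complete (core-down i j e)        = there (here (cong core (is-prev e)))
  outs-complete (core-end true i j _ e)  = there (there (here (cong (exit true) (is-at e))))
  outs-complete (core-end false i j _ e) = there (there (there (here (cong (exit false) (is-at e)))))
  outs-complete (exit-step b i j e)      = here (cong (exit b) (is-at e))
  outs-complete (leave i j e)            = there (here (cong tgt (Finₚ.toℕ-injective (sym e))))

  ins-complete : ∀ {u v} → Arc u v → u ∈ ins v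
  ins-complete (direct i)               = here refl
  ins-complete (enter i j e)            = there (here (cong src (Finₚ.toℕ-injective (sym e))))
  ins-complete (lane-step b i j e)      = here (cong (lane b) (is-prev e))
  ins-complete (lane-end true i j e _)  = there (there (here (cong (lane true) (is-at e))))
  ins-complete (lane-end false i j e _) = there (there (there (here (cong (lane false) (is-at e)))))
  ins-complete (core-up i j e)          = there (here (cong core (is-prev e)))
  ins-complete (core-down i j e)        = here (cong core (is-at e))
  ins-complete (core-end b i j e _)     = there (here (cong core (is-at e)))
  ins-complete (exit-step b i j e)      = here (cong (exit b) (is-prev e))
  ins-complete (leave i j e) with dir j
  ... | true  = there (here (cong (exit true) (Finₚ.toℕ-injective e)))
  ... | false = there (there (here (cong (exit false) (Finₚ.toℕ-injective e))))

  in-degree≤4 : ∀ v → indeg family v ≤ 4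
  in-degree≤4 v = ≤-trans
    (count-bound (λ u → arcN u v) (allFin n) (map enc (ins (dec v))) (Uniqueₚ.allFin⁺ n)
       (λ {u} _ a → subst (_∈ _) (enc-dec u) (∈-map⁺ enc (ins-complete (arc-sound {u} {v} a)))))
    (≤-trans (≤-reflexive (length-map enc (ins (dec v)))) (ins≤4 (dec v)))

  out-degree≤4 : ∀ v → outdeg family v ≤ 4
  out-degree≤4 v = ≤-trans
    (count-bound (λ u → arcN v u) (allFin n) (map enc (outs (dec v))) (Uniqueₚ.allFin⁺ n)
       (λ {u} _ a → subst (_∈ _) (enc-dec u) (∈-map⁺ enc (outs-complete (arc-sound {v} {u} a)))))
    (≤-trans (≤-reflexive (length-map enc (outs (dec v)))) (outs≤4 (dec v)))

  max-degree : MaxDegreeAtMost family 8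
  max-degree v = +-mono-≤ (in-degree≤4 v) (out-degree≤4 v)

  no-delays : Fin k → ℕ
  no-delays _ = 0

  direct-paths : Fin k → List (Fin n)
  direct-paths q = enc (src q) ∷ enc (tgt q) ∷ []

  direct-length : ∀ q → walkLen lenN (direct-paths q) ≡ L
  direct-length q rewrite dec-enc (src q) | dec-enc (tgt q) = +-identityʳ L

  -- Distinct demands use disjoint vertex sets.
  direct-feasible : Feasible family no-delays direct-paths
  direct-feasible = (λ q → refl , arc-complete (direct q) , refl) , disjoint
    where
    disjoint : ∀ i j → i ≢ j → TimeDisjoint family 0 (direct-paths i) 0 (direct-paths j)
    disjoint i j i≢j zero       zero       e = λ _ → i≢j (src-injective (enc-injective e))
      where
      src-injective : ∀ {i j} → src i ≡ src j → i ≡ j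
      src-injective refl = refl
    disjoint i j i≢j zero       (suc zero) e with enc-injective {src i} {tgt j} e
    ... | ()
    disjoint i j i≢j (suc zero) zero       e with enc-injective {tgt i} {src j} e
    ... | ()
    disjoint i j i≢j (suc zero) (suc zero) e = λ _ → i≢j (tgt-injective (enc-injective e))
      where
      tgt-injective : ∀ {i j} → tgt i ≡ tgt j → i ≡ j
      tgt-injective refl = refl

  direct-cost : cost family no-delays direct-paths ≡ k * L
  direct-cost = trans (sum-allFin k _ (λ _ → L) direct-length) (constant k)
    where
    constant : ∀ m → sumTo m (λ _ → L) ≡ m * L
    constant zero    = refl
    constant (suc m) = cong (L +_) (constant m)

  -- It is optimal, since every walk from s_q to t_q has length at least L.
  direct-optimal : Optimal family no-delays direct-paths
  direct-optimal = direct-feasible , λ d' W' (walks , _) →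
    sum-mono (allFin k) (λ i → ≤-trans (≤-reflexive (direct-length i))
      (≤-trans (walk-length-bound i (W' i) (walks i)) (m≤n+m _ (d' i))))

  greedy-cost : cost family delays W ≡ sumTo k (λ t → delay t + L)
  greedy-cost = sum-allFin k _ (λ t → delay t + L) (λ i → cong (delays i +_) (W-length i))

  -- Demand t costs at least a quarter of (2t + 1)·A in the greedy output,
  odd-term : ∀ t → A * (2 * t + 1) ≤ 4 * (delay t + L)
  odd-term t = begin
    A * (2 * t + 1)                     ≡⟨ cong (λ x → A * (2 * x + 1)) (bit+2*half t) ⟩
    A * (2 * (bit t + 2 * ⌊ t /2⌋) + 1) ≤⟨ *-monoʳ-≤ A (+-monoˡ-≤ 1 (*-monoʳ-≤ 2 (+-monoˡ-≤ (2 * ⌊ t /2⌋) (bit≤1 t)))) ⟩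
    A * (2 * (1 + 2 * ⌊ t /2⌋) + 1)     ≤⟨ *-monoʳ-≤ A (three≤twelve ⌊ t /2⌋) ⟩
    A * (4 * ⌊ t /2⌋ + 12)              ≡⟨ regroup ⌊ t /2⌋ A ⟩
    4 * (delay t + L)                   ∎
    where
    open ≤-Reasoning
    three≤twelve : ∀ h → 2 * (1 + 2 * h) + 1 ≤ 4 * h + 12
    three≤twelve h = ≤-trans (≤-reflexive (solve-three h)) (+-monoʳ-≤ (4 * h) (s≤s (s≤s (s≤s z≤n))))
      where
      solve-three : ∀ h → 2 * (1 + 2 * h) + 1 ≡ 4 * h + 3
      solve-three = solve-∀
    regroup : ∀ h a → a * (4 * h + 12) ≡ 4 * (h * a + (a + a + a))
    regroup = solve-∀

  -- and the odd numbers below 2k sum to k², so the greedy output costs at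
  -- least k²A/4,
  greedy-cost-bound : k * k * A ≤ 4 * cost family delays W
  greedy-cost-bound = begin
    k * k * A                                ≡⟨ cong (_* A) (sym (sum-of-odds k)) ⟩
    sumTo k (λ t → 2 * t + 1) * A            ≡⟨ *-comm _ A ⟩
    A * sumTo k (λ t → 2 * t + 1)            ≡⟨ sym (sumTo-scale A k (λ t → 2 * t + 1)) ⟩
    sumTo k (λ t → A * (2 * t + 1))          ≤⟨ sumTo-mono k odd-term ⟩
    sumTo k (λ t → 4 * (delay t + L))        ≡⟨ sumTo-scale 4 k (λ t → delay t + L) ⟩
    4 * sumTo k (λ t → delay t + L)          ≡⟨ cong (4 *_) (sym greedy-cost) ⟩
    4 * cost family delays W                 ∎
    where open ≤-Reasoning

  -- while the optimum costs kL = 3kA.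
  ratio : 1 * k * cost family no-delays direct-paths ≤ 12 * cost family delays W
  ratio = begin
    1 * k * cost family no-delays direct-paths ≡⟨ cong (1 * k *_) direct-cost ⟩
    1 * k * (k * L)                            ≡⟨ regroup k A ⟩
    3 * (k * k * A)                            ≤⟨ *-monoʳ-≤ 3 greedy-cost-bound ⟩
    3 * (4 * cost family delays W)             ≡⟨ sym (*-assoc 3 4 (cost family delays W)) ⟩
    12 * cost family delays W                  ∎
    where
    open ≤-Reasoning
    regroup : ∀ k a → 1 * k * (k * (a + a + a)) ≡ 3 * (k * k * a)
    regroup = solve-∀

lower-bound : ∃[ D ] ∃[ p ] ∃[ q ] (0 < p) × (0 < q) ×
  (∀ m → ∃[ I ] (m ≤ Instance.k I) × MaxDegreeAtMost I D ×
     (∃[ d ] ∃[ W ] AlgOutput I d W ×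
        (∃[ d' ] ∃[ W' ] Optimal I d' W' × (p * Instance.k I * cost I d' W' ≤ q * cost I d W))))
lower-bound = 8 , 1 , 12 , s≤s z≤n , s≤s z≤n , λ m → let open LowerBound m in
  family , n≤1+n m , max-degree , delays , W , greedy-output ,
  no-delays , direct-paths , direct-optimal , ratio

open Instance using (k)

theorem6p4 :
    (∃[ C ] ∀ (I : Instance) d W → AlgOutput I d W →
       ∀ d' W' → Feasible I d' W' →
       cost I d W ≤ C * k I * cost I d' W')
    ×
    (∃[ D ] ∃[ p ] ∃[ q ] (0 < p) × (0 < q) ×
       (∀ m → ∃[ I ] (m ≤ k I) × MaxDegreeAtMost I D ×
          (∃[ d ] ∃[ W ] AlgOutput I d W ×
             (∃[ d' ] ∃[ W' ] Optimal I d' W' ×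
                (p * k I * cost I d' W' ≤ q * cost I d W)))))
theorem6p4 = (3 , UpperBound.upper-bound) , lower-bound
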